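{- Let $w\in\mathbb{Z}^n$, $b\in\mathbb{Z}$, and let $f(X)=\mathbb{1}\{w^TX\ge b\}$ for $X\in\{0,1\}^n$ be non-constant. Then $f$ has an NN representation with $2$ anchors whose resolution is $O(RES(w))$. In general, every non-constant $n$-input linear threshold function has a $2$-anchor NN representation with resolution $O(n\log n)$.
   Context: $d$ is Euclidean distance. An NN representation of a Boolean function $f:\{0,1\}^n\to\{0,1\}$ is a pair of disjoint finite sets $P,N\subset\mathbb{R}^n$ (anchors) such that for every $X$ with $f(X)=1$ there is $p\in P$ with $d(X,p)<d(X,q)$ for all $q\in N$, and for every $X$ with $f(X)=0$ there is $q\in N$ with $d(X,q)<d(X,p)$ for all $p\in P$. A linear threshold function is a function of the form $\mathbb{1}\{w^TX\ge b\}$ with $w\in\mathbb{Z}^n$, $b\in\mathbb{Z}$. The resolution of a rational $a/b$ ($a,b\in\mathbb{Z}$ coprime, $b\ne0$) is $RES(a/b)=\lceil\max\{\log_2|a+1|,\log_2|b+1|\}\rceil$; for a rational vector or matrix it is the maximum resolution of its entries; the resolution of an NN representation is the resolution of its anchor matrix (the matrix whose rows are the anchors). -}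

module Defs where

open import Data.Bool using (Bool; true; false; if_then_else_)
open import Data.Nat as ℕ using (ℕ; zero; suc; _⊔_)
open import Data.Nat.Logarithm using (⌈log₂_⌉)
open import Data.Integer as ℤ using (ℤ; ∣_∣)
open import Data.Rational as ℚ using (ℚ)
open import Data.Vec using (Vec; []; _∷_; foldr; zipWith; map)
open import Data.List as List using (List)
open import Data.List.Membership.Propositional using (_∈_)
open import Data.List.Relation.Unary.Any using (Any)
open import Data.List.Relation.Unary.All using (All)
open import Data.Product using (Σ; _×_; ∃)
open import Relation.Nullary using (¬_; yes; no)
open import Relation.Binary.PropositionalEquality using (_≡_)

BVec : ℕ → Set
BVec n = Vec Bool n

bitℤ : Bool → ℤ
bitℤ b = if b then ℤ.1ℤ else ℤ.0ℤ

bitℚ : Bool → ℚ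
bitℚ b = if b then ℚ.1ℚ else ℚ.0ℚ

dotℤ : ∀ {n} → Vec ℤ n → BVec n → ℤ
dotℤ w X = foldr _ ℤ._+_ ℤ.0ℤ (zipWith (λ wi xi → wi ℤ.* bitℤ xi) w X)

LTF : ∀ {n} → Vec ℤ n → ℤ → BVec n → Bool
LTF w b X with dotℤ w X ℤ.<? b
... | yes _ = false
... | no _ = true

NonConstant : ∀ {n} → (BVec n → Bool) → Set
NonConstant {n} f = Σ (BVec n) (λ X → Σ (BVec n) (λ Y → f X ≡ true × f Y ≡ false))

-- squared Euclidean distance between a Boolean point and a rational anchor
-- (comparing d² is equivalent to comparing d, since d ≥ 0)
dist² : ∀ {n} → BVec n → Vec ℚ n → ℚ
dist² X p = foldr _ ℚ._+_ ℚ.0ℚ (zipWith (λ xi pi → (bitℚ xi ℚ.- pi) ℚ.* (bitℚ xi ℚ.- pi)) X p)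

CloserTo : ∀ {n} → BVec n → List (Vec ℚ n) → List (Vec ℚ n) → Set
CloserTo X P N = Any (λ p → All (λ q → dist² X p ℚ.< dist² X q) N) P

NNRep : ∀ {n} → (BVec n → Bool) → List (Vec ℚ n) → List (Vec ℚ n) → Set
NNRep f P N =
  (∀ x → ¬ (x ∈ P × x ∈ N)) ×
  (∀ X → (f X ≡ true → CloserTo X P N) × (f X ≡ false → CloserTo X N P))

-- RES(a/b) = ⌈max{log₂|a+1|, log₂|b+1|}⌉ with a/b in lowest terms, b > 0
-- (= max of the two ceilings; ⌈log₂ 0⌉ is irrelevant since b+1 ≥ 2)
RESℚ : ℚ → ℕ
RESℚ q = ⌈log₂ ∣ ℚ.numerator q ℤ.+ ℤ.1ℤ ∣ ⌉ ⊔ ⌈log₂ suc (ℚ.denominatorℕ q) ⌉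

RESℤvec : ∀ {n} → Vec ℤ n → ℕ
RESℤvec w = foldr _ (λ wi r → RESℚ (wi ℚ./ 1) ⊔ r) 0 w

RESℚvec : ∀ {n} → Vec ℚ n → ℕ
RESℚvec p = foldr _ (λ pi r → RESℚ pi ⊔ r) 0 p

RESrep : ∀ {n} → List (Vec ℚ n) → List (Vec ℚ n) → ℕ
RESrep P N = List.foldr (λ p r → RESℚvec p ⊔ r) 0 (P List.++ N)

module Submission where

-- Let x⁺ be a true input of least weight w·x⁺ and x⁻ a false input of greatest weight. The
-- anchors (x⁺ + x⁻ ± w)/2 have as bisector the hyperplane 2 w·X = w·x⁺ + w·x⁻, which lies strictly
-- between the two classes, and their entries are of the size of w, so the resolution is O(RES(w)).
--
-- For the O(n log n) bound the weights are first made small. The integer points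
-- (margin, threshold, weights) that realise f form a cone cut out by ternary constraints; from a
-- feasible point, ratio tests walk to a vertex, where the point is a cofactor vector of a ternary
-- matrix and hence bounded by (n+1)!, giving resolution O(log (n+1)!) = O(n log n).

open import Defs

module Search where

  open import Data.Nat using (ℕ; zero; suc; _+_)
  open import Data.Fin using (Fin; zero; suc; _↑ˡ_; _↑ʳ_; splitAt)
  open import Data.Fin.Properties using (splitAt-↑ˡ; splitAt-↑ʳ)
  open import Data.Bool using (Bool; true; false)
  open import Data.Vec using (Vec; []; _∷_)
  open import Data.Product using (Σ; ∃; _×_; _,_)
  open import Data.Sum using (_⊎_; inj₁; inj₂; [_,_]′)
  open import Data.Empty using (⊥-elim)
  open import Function using (_∘_; id)
  open import Relation.Nullary using (¬_; Dec; yes; no)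
  open import Relation.Binary.PropositionalEquality

  leastOrNone : ∀ {K} {P : Fin K → Set} → (∀ k → Dec (P k)) → (_≼_ : Fin K → Fin K → Set) →
    (∀ i j → i ≼ j ⊎ j ≼ i) → (∀ {i j l} → P i → P j → P l → i ≼ j → j ≼ l → i ≼ l) →
    (Σ (Fin K) λ k → P k × ∀ j → P j → k ≼ j) ⊎ (∀ j → ¬ P j)
  leastOrNone {zero} P? _≼_ total trans-≼ = inj₂ λ ()
  leastOrNone {suc K} P? _≼_ total trans-≼
    with leastOrNone (P? ∘ suc) (λ i j → suc i ≼ suc j) (λ i j → total (suc i) (suc j)) trans-≼ | P? zero
  ... | inj₂ none | no ¬p₀ = inj₂ λ { zero → ¬p₀ ; (suc j) → none j }
  ... | inj₂ none | yes p₀ =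
    inj₁ (zero , p₀ , λ { zero _ → [ id , id ]′ (total zero zero) ; (suc j) pj → ⊥-elim (none j pj) })
  ... | inj₁ (k , pk , k-least) | no ¬p₀ =
    inj₁ (suc k , pk , λ { zero p₀ → ⊥-elim (¬p₀ p₀) ; (suc j) pj → k-least j pj })
  ... | inj₁ (k , pk , k-least) | yes p₀ with total zero (suc k)
  ...   | inj₁ 0≼k = inj₁ (zero , p₀ , λ { zero _ → [ id , id ]′ (total zero zero)
                                         ; (suc j) pj → trans-≼ p₀ pk pj 0≼k (k-least j pj) })
  ...   | inj₂ k≼0 = inj₁ (suc k , pk , λ { zero _ → k≼0 ; (suc j) pj → k-least j pj })

  least : ∀ {K} {P : Fin K → Set} → (∀ k → Dec (P k)) → (_≼_ : Fin K → Fin K → Set) →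
    (∀ i j → i ≼ j ⊎ j ≼ i) → (∀ {i j l} → P i → P j → P l → i ≼ j → j ≼ l → i ≼ l) →
    ∃ P → Σ (Fin K) λ k → P k × ∀ j → P j → k ≼ j
  least P? _≼_ total trans-≼ (k , pk) = [ id , (λ none → ⊥-elim (none k pk)) ]′
    (leastOrNone P? _≼_ total trans-≼)

  cardinality : ℕ → ℕ
  cardinality zero = 1
  cardinality (suc n) = cardinality n + cardinality n

  enumerate : ∀ {n} → Fin (cardinality n) → Vec Bool n
  enumerate {zero} _ = []
  enumerate {suc n} i = [ (false ∷_) ∘ enumerate , (true ∷_) ∘ enumerate ]′ (splitAt (cardinality n) i)

  enumerate-surjective : ∀ {n} (X : Vec Bool n) → Σ (Fin (cardinality n)) λ k → enumerate k ≡ X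
  enumerate-surjective [] = zero , refl
  enumerate-surjective {suc n} (false ∷ X) with enumerate-surjective X
  ... | k , refl = k ↑ˡ cardinality n ,
    cong [ (false ∷_) ∘ enumerate , (true ∷_) ∘ enumerate ]′ (splitAt-↑ˡ (cardinality n) k (cardinality n))
  enumerate-surjective {suc n} (true ∷ X) with enumerate-surjective X
  ... | k , refl = cardinality n ↑ʳ k ,
    cong [ (false ∷_) ∘ enumerate , (true ∷_) ∘ enumerate ]′ (splitAt-↑ʳ (cardinality n) (cardinality n) k)

  optimalInput : ∀ {n} {B : Set} {P : Vec Bool n → Set} → (∀ X → Dec (P X)) → (_≼_ : B → B → Set) →
    (∀ a b → a ≼ b ⊎ b ≼ a) → (∀ {a b c} → a ≼ b → b ≼ c → a ≼ c) → (g : Vec Bool n → B) →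
    ∃ P → Σ (Vec Bool n) λ X → P X × ∀ Y → P Y → g X ≼ g Y
  optimalInput {n} {B} {P} P? _≼_ total trans-≼ g (X , pX) with enumerate-surjective X
  ... | k , refl with least (λ k → P? (enumerate k)) (λ i j → g (enumerate i) ≼ g (enumerate j))
                            (λ i j → total (g (enumerate i)) (g (enumerate j))) (λ _ _ _ → trans-≼) (k , pX)
  ... | k* , pk* , k*-optimal = enumerate k* , pk* , optimal
    where
    optimal : ∀ Y → P Y → g (enumerate k*) ≼ g Y
    optimal Y pY with enumerate-surjective Y
    ... | j , refl = k*-optimal j pY

module Determinants where

  open import Data.Nat as ℕ using (ℕ; zero; suc; _!)
  import Data.Nat.Properties as ℕP
  open import Data.Fin using (Fin; zero; suc; punchIn)
  open import Data.Vec.Functional using (Vector; _∷_)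
  open import Data.Integer using (ℤ; -_; _+_; _*_; 0ℤ; 1ℤ; -1ℤ; ∣_∣)
  open import Data.Integer.Properties
  open import Data.Integer.Tactic.RingSolver using (solve-∀)
  open import Algebra.Properties.Semiring.Sum +-*-semiring
    using (sum; sum-cong-≗; ∑-distrib-+; ∑-comm; sum-remove; *-distribˡ-sum; sum-replicate-zero)
  open import Algebra.Properties.CommutativeSemigroup *-commutativeSemigroup using (x∙yz≈y∙xz; x∙yz≈z∙yx)
  open import Algebra.Bundles using (AbelianGroup)
  open import Algebra.Properties.Group (AbelianGroup.group +-0-abelianGroup) using (inverseˡ-unique)
  open import Data.Empty using (⊥-elim)
  open import Data.Sum using ([_,_]′)
  open import Function using (_∘_; id)
  open import Relation.Binary.PropositionalEquality
  open ≡-Reasoning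

  infix 7 _·_

  _·_ : ∀ {n} → Vector ℤ n → Vector ℤ n → ℤ
  u · v = sum (λ i → u i * v i)

  ·-comm : ∀ {n} (u v : Vector ℤ n) → u · v ≡ v · u
  ·-comm u v = sum-cong-≗ (λ c → *-comm (u c) (v c))

  ·-congʳ : ∀ {n} (u : Vector ℤ n) {x y : Vector ℤ n} → (∀ c → x c ≡ y c) → u · x ≡ u · y
  ·-congʳ u x≗y = sum-cong-≗ (λ c → cong (u c *_) (x≗y c))

  ·-congˡ : ∀ {n} {x y : Vector ℤ n} (u : Vector ℤ n) → (∀ c → x c ≡ y c) → x · u ≡ y · u
  ·-congˡ u x≗y = sum-cong-≗ (λ c → cong (_* u c) (x≗y c))

  ·-zeroʳ : ∀ {n} (u : Vector ℤ n) {y : Vector ℤ n} → (∀ c → y c ≡ 0ℤ) → u · y ≡ 0ℤ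
  ·-zeroʳ {n} u y≗0 = trans (sum-cong-≗ (λ c → trans (cong (u c *_) (y≗0 c)) (*-zeroʳ (u c))))
                            (sum-replicate-zero n)

  ·-zeroˡ : ∀ {n} {u : Vector ℤ n} (y : Vector ℤ n) → (∀ c → u c ≡ 0ℤ) → u · y ≡ 0ℤ
  ·-zeroˡ {n} {u} y u≗0 = trans (sum-cong-≗ (λ c → trans (cong (_* y c) (u≗0 c)) (*-zeroˡ (y c))))
                                (sum-replicate-zero n)

  ·-scaleʳ : ∀ {n} (u x : Vector ℤ n) (a : ℤ) → u · (λ c → a * x c) ≡ a * (u · x)
  ·-scaleʳ u x a = trans (sum-cong-≗ (λ c → x∙yz≈y∙xz (u c) a (x c)))
                         (sym (*-distribˡ-sum a (λ c → u c * x c)))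

  ·-negʳ : ∀ {n} (u y : Vector ℤ n) → u · (λ c → - y c) ≡ - (u · y)
  ·-negʳ u y = begin
    sum (λ c → u c * - y c)
      ≡⟨ sum-cong-≗ (λ c → trans (sym (neg-distribʳ-* (u c) (y c))) (sym (-1*i≡-i (u c * y c)))) ⟩
    sum (λ c → -1ℤ * (u c * y c))   ≡⟨ *-distribˡ-sum -1ℤ (λ c → u c * y c) ⟨
    -1ℤ * (u · y)                   ≡⟨ -1*i≡-i (u · y) ⟩
    - (u · y)                       ∎

  ·-distribʳ-+ : ∀ {n} (x y u : Vector ℤ n) → (λ c → x c + y c) · u ≡ x · u + y · u
  ·-distribʳ-+ x y u = trans (sum-cong-≗ (λ c → *-distribʳ-+ (u c) (x c) (y c)))
                             (∑-distrib-+ (λ c → x c * u c) (λ c → y c * u c))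

  ·-distribˡ-+ : ∀ {n} (u x y : Vector ℤ n) → u · (λ c → x c + y c) ≡ u · x + u · y
  ·-distribˡ-+ u x y = trans (sum-cong-≗ (λ c → *-distribˡ-+ (u c) (x c) (y c)))
                             (∑-distrib-+ (λ c → u c * x c) (λ c → u c * y c))

  ·-linearʳ : ∀ {n} (u x y : Vector ℤ n) (a b : ℤ) →
    u · (λ c → a * x c + b * y c) ≡ a * (u · x) + b * (u · y)
  ·-linearʳ u x y a b = trans (·-distribˡ-+ u (λ c → a * x c) (λ c → b * y c))
                              (cong₂ _+_ (·-scaleʳ u x a) (·-scaleʳ u y b))

  unit : ∀ {n} → Fin n → Vector ℤ n
  unit zero = 1ℤ ∷ λ _ → 0ℤ
  unit (suc i) = 0ℤ ∷ unit i

  unit·y≡y : ∀ {n} (c : Fin n) (y : Vector ℤ n) → unit c · y ≡ y c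
  unit·y≡y zero y = trans (cong₂ _+_ (*-identityˡ (y zero)) (·-zeroˡ (y ∘ suc) (λ _ → refl)))
                          (+-identityʳ (y zero))
  unit·y≡y (suc c) y = trans (cong (0ℤ * y zero +_) (unit·y≡y c (y ∘ suc))) (+-identityˡ (y (suc c)))

  sign : ∀ {n} → Fin n → ℤ
  sign zero = 1ℤ
  sign (suc i) = - sign i

  sign*sign≡1 : ∀ {n} (i : Fin n) → sign i * sign i ≡ 1ℤ
  sign*sign≡1 zero = refl
  sign*sign≡1 (suc i) = trans (neg-*-neg (sign i)) (sign*sign≡1 i)
    where
    neg-*-neg : ∀ a → (- a) * (- a) ≡ a * a
    neg-*-neg = solve-∀

  sign-cancel : ∀ {n} (i : Fin n) {x} → sign i * x ≡ 0ℤ → x ≡ 0ℤ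
  sign-cancel i {x} sx≡0 = begin
    x                      ≡⟨ sym (*-identityˡ x) ⟩
    1ℤ * x                 ≡⟨ cong (_* x) (sym (sign*sign≡1 i)) ⟩
    sign i * sign i * x    ≡⟨ *-assoc (sign i) (sign i) x ⟩
    sign i * (sign i * x)  ≡⟨ cong (sign i *_) sx≡0 ⟩
    sign i * 0ℤ            ≡⟨ *-zeroʳ (sign i) ⟩
    0ℤ                     ∎

  Matrix : ℕ → ℕ → Set
  Matrix m n = Vector (Vector ℤ n) m

  removeColumn : ∀ {m n} → Matrix m (suc n) → Fin (suc n) → Matrix m n
  removeColumn R c i = R i ∘ punchIn c

  mutual
    det : ∀ {n} → Matrix n n → ℤ
    det {zero} M = 1ℤ
    det {suc n} M = M zero · cofactors (M ∘ suc)

    cofactors : ∀ {n} → Matrix n (suc n) → Vector ℤ (suc n)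
    cofactors R c = sign c * det (removeColumn R c)

  det-cong : ∀ {n} {M N : Matrix n n} → (∀ i j → M i j ≡ N i j) → det M ≡ det N
  det-cong {zero} M≗N = refl
  det-cong {suc n} M≗N = sum-cong-≗ (λ c → cong₂ _*_ (M≗N zero c)
    (cong (sign c *_) (det-cong (λ i j → M≗N (suc i) (punchIn c j)))))

  det-unit : ∀ {n} → det {n} unit ≡ 1ℤ
  det-unit {zero} = refl
  det-unit {suc n} = cong₂ (λ d z → 1ℤ * (1ℤ * d) + z) (det-unit {n})
    (·-zeroˡ {n} {u = λ _ → 0ℤ} (λ c → sign (suc c) * det (removeColumn (unit ∘ suc) (suc c))) (λ _ → refl))

  minor : ∀ {m n} → Matrix (suc m) (suc n) → Fin (suc m) → Fin (suc n) → Matrix m n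
  minor M r c i j = M (punchIn r i) (punchIn c j)

  private
    pull-into-sum : ∀ {n} x y (f : Vector ℤ n) → x * (- y * sum f) ≡ sum (λ i → - (x * y) * f i)
    pull-into-sum x y f = trans (reassociate x y (sum f)) (*-distribˡ-sum (- (x * y)) f)
      where
      reassociate : ∀ x y z → x * (- y * z) ≡ - (x * y) * z
      reassociate = solve-∀

  det-firstColumn : ∀ {n} (M : Matrix (suc n) (suc n)) →
    det M ≡ sum (λ r → M r zero * (sign r * det (minor M r zero)))
  det-firstColumn {zero} M = refl
  det-firstColumn {suc n} M = cong (M zero zero * (1ℤ * det (minor M zero zero)) +_) (begin
      sum (λ c → a c * (- sign c * det (minor M zero (suc c))))
    ≡⟨ sum-cong-≗ (λ c → cong (λ d → a c * (- sign c * d)) (det-firstColumn (minor M zero (suc c)))) ⟩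
      sum (λ c → a c * (- sign c * sum (λ r → b r * (sign r * D r c))))
    ≡⟨ sum-cong-≗ (λ c → pull-into-sum (a c) (sign c) (λ r → b r * (sign r * D r c))) ⟩
      sum (λ c → sum (λ r → - (a c * sign c) * (b r * (sign r * D r c))))
    ≡⟨ ∑-comm (λ c r → - (a c * sign c) * (b r * (sign r * D r c))) ⟩
      sum (λ r → sum (λ c → - (a c * sign c) * (b r * (sign r * D r c))))
    ≡⟨ sum-cong-≗ (λ r → sum-cong-≗ (λ c → exchange (a c) (sign c) (b r) (sign r) (D r c))) ⟩
      sum (λ r → sum (λ c → - (b r * sign r) * (a c * (sign c * D r c))))
    ≡⟨ sum-cong-≗ (λ r → sym (pull-into-sum (b r) (sign r) (λ c → a c * (sign c * D r c)))) ⟩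
      sum (λ r → b r * (- sign r * det (minor M (suc r) zero)))
    ∎)
    where
    a b : Vector ℤ (suc n)
    a c = M zero (suc c)
    b r = M (suc r) zero
    D : Fin (suc n) → Fin (suc n) → ℤ
    D r c = det (λ i j → M (suc (punchIn r i)) (suc (punchIn c j)))
    exchange : ∀ a s b t d → - (a * s) * (b * (t * d)) ≡ - (b * t) * (a * (s * d))
    exchange = solve-∀

  det-transpose : ∀ {n} (M : Matrix n n) → det (λ i j → M j i) ≡ det M
  det-transpose {zero} M = refl
  det-transpose {suc n} M = trans
    (sum-cong-≗ (λ c → cong (λ d → M c zero * (sign c * d)) (det-transpose (minor M c zero))))
    (sym (det-firstColumn M))

  det-equalRows : ∀ {n} (M : Matrix (suc (suc n)) (suc (suc n))) →
    (∀ j → M zero j ≡ M (suc zero) j) → det M ≡ 0ℤ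
  det-equalRows {n} M row₀≡row₁ = begin
    det M
      ≡⟨ det-firstColumn M ⟩
    a₀ * (1ℤ * d₀) + (a₁ * (- 1ℤ * d₁) + rest)
      ≡⟨ cong (λ z → a₀ * (1ℤ * d₀) + (a₁ * (- 1ℤ * d₁) + z)) (rest≡0 n M row₀≡row₁) ⟩
    a₀ * (1ℤ * d₀) + (a₁ * (- 1ℤ * d₁) + 0ℤ)
      ≡⟨ cong₂ (λ a d → a * (1ℤ * d) + (a₁ * (- 1ℤ * d₁) + 0ℤ)) (row₀≡row₁ zero) (det-cong minors-agree) ⟩
    a₁ * (1ℤ * d₁) + (a₁ * (- 1ℤ * d₁) + 0ℤ)
      ≡⟨ cancel a₁ d₁ ⟩
    0ℤ ∎
    where
    a₀ a₁ d₀ d₁ rest : ℤ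
    a₀ = M zero zero
    a₁ = M (suc zero) zero
    d₀ = det (minor M zero zero)
    d₁ = det (minor M (suc zero) zero)
    rest = sum (λ r → M (suc (suc r)) zero * (sign (suc (suc r)) * det (minor M (suc (suc r)) zero)))
    rest≡0 : ∀ n (M : Matrix (suc (suc n)) (suc (suc n))) → (∀ j → M zero j ≡ M (suc zero) j) →
      sum (λ r → M (suc (suc r)) zero * (sign (suc (suc r)) * det (minor M (suc (suc r)) zero))) ≡ 0ℤ
    rest≡0 zero M _ = refl
    rest≡0 (suc n) M row₀≡row₁ = ·-zeroʳ (λ r → M (suc (suc r)) zero) (λ r →
      trans (cong (sign (suc (suc r)) *_) (det-equalRows (minor M (suc (suc r)) zero) (row₀≡row₁ ∘ suc)))
            (*-zeroʳ (sign (suc (suc r)))))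
    minors-agree : ∀ i j → minor M zero zero i j ≡ minor M (suc zero) zero i j
    minors-agree zero j = sym (row₀≡row₁ (suc j))
    minors-agree (suc i) j = refl
    cancel : ∀ a d → a * (1ℤ * d) + (a * (- 1ℤ * d) + 0ℤ) ≡ 0ℤ
    cancel = solve-∀

  det-additive₁ : ∀ {n} (x y z : Vector ℤ (suc (suc n))) (R : Matrix n (suc (suc n))) →
    det (x ∷ (λ j → y j + z j) ∷ R) ≡ det (x ∷ y ∷ R) + det (x ∷ z ∷ R)
  det-additive₁ x y z R =
    trans (·-congʳ x cofactors-additive) (·-distribˡ-+ x (cofactors (y ∷ R)) (cofactors (z ∷ R)))
    where
    cofactors-additive : ∀ c → cofactors ((λ j → y j + z j) ∷ R) c ≡ cofactors (y ∷ R) c + cofactors (z ∷ R) c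
    cofactors-additive c = trans
      (cong (sign c *_) (·-distribʳ-+ (y ∘ punchIn c) (z ∘ punchIn c) (cofactors (removeColumn R c))))
      (*-distribˡ-+ (sign c) _ _)

  det-swap : ∀ {n} (x y : Vector ℤ (suc (suc n))) (R : Matrix n (suc (suc n))) →
    det (x ∷ y ∷ R) ≡ - det (y ∷ x ∷ R)
  det-swap x y R = inverseˡ-unique (D x y) (D y x) (begin
    D x y + D y x                     ≡⟨ pad (D x y) (D y x) ⟩
    0ℤ + D x y + (D y x + 0ℤ)         ≡⟨ cong₂ (λ a b → a + D x y + (D y x + b)) (D-same x) (D-same y) ⟨
    D x x + D x y + (D y x + D y y)   ≡⟨ cong₂ _+_ (det-additive₁ x x y R) (det-additive₁ y x y R) ⟨
    D x s + D y s                     ≡⟨ ·-distribʳ-+ x y (cofactors (s ∷ R)) ⟨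
    D s s                             ≡⟨ D-same s ⟩
    0ℤ                                ∎)
    where
    D : Vector ℤ _ → Vector ℤ _ → ℤ
    D u v = det (u ∷ v ∷ R)
    D-same : ∀ u → D u u ≡ 0ℤ
    D-same u = det-equalRows (u ∷ u ∷ R) (λ _ → refl)
    s : Vector ℤ _
    s j = x j + y j
    pad : ∀ a b → a + b ≡ 0ℤ + a + (b + 0ℤ)
    pad = solve-∀

  toFront : ∀ {n} → Fin (suc n) → Fin (suc n) → Fin (suc n)
  toFront p = p ∷ punchIn p

  mutual
    det-toFront : ∀ {n} (p : Fin (suc n)) (M : Matrix (suc n) (suc n)) →
      det (M ∘ toFront p) ≡ sign p * det M
    det-toFront zero M = trans (det-cong {M = M ∘ toFront zero} {N = M} λ { zero j → refl ; (suc i) j → refl })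
                               (sym (*-identityˡ (det M)))
    det-toFront {suc n} (suc p) M = begin
      det (M (suc p) ∷ M zero ∷ M ∘ suc ∘ punchIn p)
        ≡⟨ det-swap (M (suc p)) (M zero) (M ∘ suc ∘ punchIn p) ⟩
      - det (M zero ∷ M ∘ suc ∘ toFront p)
        ≡⟨ cong -_ (·-congʳ (M zero) (cofactors-toFront p (M ∘ suc))) ⟩
      - (M zero · (λ c → sign p * cofactors (M ∘ suc) c))
        ≡⟨ cong -_ (·-scaleʳ (M zero) (cofactors (M ∘ suc)) (sign p)) ⟩
      - (sign p * det M)
        ≡⟨ neg-distribˡ-* (sign p) (det M) ⟩
      - sign p * det M ∎

    cofactors-toFront : ∀ {n} (p : Fin (suc n)) (R : Matrix (suc n) (suc (suc n))) c →
      cofactors (R ∘ toFront p) c ≡ sign p * cofactors R c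
    cofactors-toFront p R c = trans (cong (sign c *_) (det-toFront p (removeColumn R c)))
                                    (x∙yz≈y∙xz (sign c) (sign p) (det (removeColumn R c)))

  cofactors-orthogonal : ∀ {n} (R : Matrix n (suc n)) i → R i · cofactors R ≡ 0ℤ
  cofactors-orthogonal {suc n} R i = sign-cancel i (begin
    sign i * (R i · cofactors R)            ≡⟨ ·-scaleʳ (R i) (cofactors R) (sign i) ⟨
    R i · (λ c → sign i * cofactors R c)    ≡⟨ ·-congʳ (R i) (cofactors-toFront i R) ⟨
    det (R i ∷ R i ∷ R ∘ punchIn i)         ≡⟨ det-equalRows (R i ∷ R i ∷ R ∘ punchIn i) (λ _ → refl) ⟩
    0ℤ                                      ∎)

  -- Pairing the equations with the cofactors of the columns other than p leaves  y p * det L = 0.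
  det≢0⇒kernel-trivial : ∀ {n} (L : Matrix n n) {y : Vector ℤ n} → det L ≢ 0ℤ →
    (∀ i → L i · y ≡ 0ℤ) → ∀ p → y p ≡ 0ℤ
  det≢0⇒kernel-trivial {suc n} L {y} detL≢0 Ly≡0 p =
    [ id , (λ g·Lp≡0 → ⊥-elim (detL≢0 (sign-cancel p (trans (sym column-det) g·Lp≡0)))) ]′
      (i*j≡0⇒i≡0∨j≡0 (y p) (begin
        y p * (A p · g)                                      ≡⟨ +-identityʳ _ ⟨
        y p * (A p · g) + 0ℤ                                 ≡⟨ cong (y p * (A p · g) +_) other-columns ⟨
        y p * (A p · g) + sum (λ q → y (punchIn p q) * (A (punchIn p q) · g))
                                                             ≡⟨ sum-remove (λ q → y q * (A q · g)) ⟨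
        sum (λ q → y q * (A q · g))                          ≡⟨ regroup ⟩
        g · (λ c → L c · y)                                  ≡⟨ ·-zeroʳ g Ly≡0 ⟩
        0ℤ                                                   ∎))
    where
    A : Matrix (suc n) (suc n)
    A q c = L c q
    g : Vector ℤ (suc n)
    g = cofactors (A ∘ punchIn p)
    column-det : A p · g ≡ sign p * det L
    column-det = trans (det-toFront p A) (cong (sign p *_) (det-transpose L))
    other-columns : sum (λ q → y (punchIn p q) * (A (punchIn p q) · g)) ≡ 0ℤ
    other-columns = ·-zeroʳ (y ∘ punchIn p) (cofactors-orthogonal (A ∘ punchIn p))
    regroup : sum (λ q → y q * (A q · g)) ≡ g · (λ c → L c · y)
    regroup = begin
      sum (λ q → y q * sum (λ c → L c q * g c))
        ≡⟨ sum-cong-≗ (λ q → *-distribˡ-sum (y q) (λ c → L c q * g c)) ⟩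
      sum (λ q → sum (λ c → y q * (L c q * g c)))
        ≡⟨ ∑-comm (λ q c → y q * (L c q * g c)) ⟩
      sum (λ c → sum (λ q → y q * (L c q * g c)))
        ≡⟨ sum-cong-≗ (λ c → sum-cong-≗ (λ q → x∙yz≈z∙yx (y q) (L c q) (g c))) ⟩
      sum (λ c → sum (λ q → g c * (L c q * y q)))
        ≡⟨ sum-cong-≗ (λ c → *-distribˡ-sum (g c) (λ q → L c q * y q)) ⟨
      g · (λ c → L c · y) ∎

  ∣sum∣≤ : ∀ {n} (f : Vector ℤ n) {B} → (∀ i → ∣ f i ∣ ℕ.≤ B) → ∣ sum f ∣ ℕ.≤ n ℕ.* B
  ∣sum∣≤ {zero} f _ = ℕ.z≤n
  ∣sum∣≤ {suc n} f ∣f∣≤B = ℕP.≤-trans (∣i+j∣≤∣i∣+∣j∣ (f zero) (sum (f ∘ suc)))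
                                      (ℕP.+-mono-≤ (∣f∣≤B zero) (∣sum∣≤ (f ∘ suc) (∣f∣≤B ∘ suc)))

  ∣sign∣≡1 : ∀ {n} (i : Fin n) → ∣ sign i ∣ ≡ 1
  ∣sign∣≡1 zero = refl
  ∣sign∣≡1 (suc i) = trans (∣-i∣≡∣i∣ (sign i)) (∣sign∣≡1 i)

  ∣sign*x∣≡∣x∣ : ∀ {n} (i : Fin n) x → ∣ sign i * x ∣ ≡ ∣ x ∣
  ∣sign*x∣≡∣x∣ i x =
    trans (abs-* (sign i) x) (trans (cong (ℕ._* ∣ x ∣) (∣sign∣≡1 i)) (ℕP.*-identityˡ ∣ x ∣))

  Ternary : ∀ {m n} → Matrix m n → Set
  Ternary M = ∀ i j → ∣ M i j ∣ ℕ.≤ 1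

  mutual
    ∣det∣≤! : ∀ {n} (M : Matrix n n) → Ternary M → ∣ det M ∣ ℕ.≤ n !
    ∣det∣≤! {zero} M _ = ℕP.≤-refl
    ∣det∣≤! {suc n} M ternary = ∣sum∣≤ (λ c → M zero c * cofactors (M ∘ suc) c) λ c →
      ℕP.≤-trans (ℕP.≤-reflexive (abs-* (M zero c) (cofactors (M ∘ suc) c)))
                (ℕP.≤-trans (ℕP.*-mono-≤ (ternary zero c) (∣cofactors∣≤! (M ∘ suc) (ternary ∘ suc) c))
                           (ℕP.≤-reflexive (ℕP.*-identityˡ (n !))))

    ∣cofactors∣≤! : ∀ {n} (R : Matrix n (suc n)) → Ternary R → ∀ c → ∣ cofactors R c ∣ ℕ.≤ n !
    ∣cofactors∣≤! R ternary c = ℕP.≤-trans (ℕP.≤-reflexive (∣sign*x∣≡∣x∣ c (det (removeColumn R c))))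
                                          (∣det∣≤! (removeColumn R c) (λ i j → ternary i (punchIn c j)))

  unit-ternary : ∀ {n} → Ternary (unit {n})
  unit-ternary zero zero = ℕP.≤-refl
  unit-ternary zero (suc j) = ℕ.z≤n
  unit-ternary (suc i) zero = ℕ.z≤n
  unit-ternary (suc i) (suc j) = unit-ternary i j

module Exchange where

  open Determinants
  open import Data.Nat as ℕ using (ℕ; zero; suc)
  import Data.Nat.Properties as ℕP
  open import Data.Fin using (Fin; zero; suc; punchIn)
  open import Data.Fin.Properties using (any?)
  open import Data.Vec.Functional using (Vector; _∷_)
  open import Data.Integer using (ℤ; 0ℤ; 1ℤ)
  open import Data.Integer.Properties using (_≟_)
  import Algebra.Properties.Semiring.Sum ℕP.+-*-semiring as ℕΣ
  open import Data.Product using (Σ; _×_; _,_; proj₁; proj₂)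
  open import Data.Sum using (_⊎_; inj₁; inj₂; [_,_]′)
  open import Data.Unit using (⊤; tt)
  open import Data.Empty using (⊥; ⊥-elim)
  open import Function using (_∘_; const)
  open import Relation.Nullary using (¬_; Dec; yes; no; ¬?; _×-dec_; decidable-stable)
  open import Relation.Binary.PropositionalEquality

  module _ {m K : ℕ} (S : Fin K → Vector ℤ (suc m)) {A : Fin K → Set} (A? : ∀ k → Dec (A k)) where

    NonsingularSelection : Set
    NonsingularSelection = Σ (Fin (suc m) → Fin K) λ idx → (∀ i → A (idx i)) × det (S ∘ idx) ≢ 0ℤ

    OrthogonalVector : Set
    OrthogonalVector = Σ (Vector ℤ (suc m)) λ y → ¬ (∀ c → y c ≡ 0ℤ) × (∀ k → A k → S k · y ≡ 0ℤ)

    private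
      Row : Set
      Row = Σ (Fin K) A ⊎ Fin (suc m)

      vector : Row → Vector ℤ (suc m)
      vector = [ S ∘ proj₁ , unit ]′

      IsUnit : Row → Set
      IsUnit = [ const ⊥ , const ⊤ ]′

      isUnit? : ∀ r → Dec (IsUnit r)
      isUnit? (inj₁ _) = no λ ()
      isUnit? (inj₂ _) = yes tt

      count : Row → ℕ
      count = [ const 0 , const 1 ]′

      units : ∀ {n} → (Fin n → Row) → ℕ
      units rows = ℕΣ.sum (count ∘ rows)

      units-unit : ∀ {n} (c : Fin n → Fin (suc m)) → units (inj₂ ∘ c) ≡ n
      units-unit {zero} c = refl
      units-unit {suc n} c = cong suc (units-unit (c ∘ suc))

      selected : ∀ r → ¬ IsUnit r → Σ (Fin K) A
      selected (inj₁ s) _ = s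
      selected (inj₂ _) ¬unit = ⊥-elim (¬unit tt)

      vector-selected : ∀ r (¬unit : ¬ IsUnit r) → vector r ≡ S (proj₁ (selected r ¬unit))
      vector-selected (inj₁ _) _ = refl
      vector-selected (inj₂ _) ¬unit = ⊥-elim (¬unit tt)

      units-remove : ∀ {n} (rows : Fin (suc n) → Row) p → IsUnit (rows p) →
        units rows ≡ suc (units (rows ∘ punchIn p))
      units-remove rows p unitAtP =
        trans (ℕΣ.sum-remove {i = p} (count ∘ rows))
              (cong (ℕ._+ units (rows ∘ punchIn p)) (count-unit (rows p) unitAtP))
        where
        count-unit : ∀ r → IsUnit r → count r ≡ 1
        count-unit (inj₂ _) _ = refl

      complement : (Fin (suc m) → Row) → Fin (suc m) → Vector ℤ (suc m)
      complement rows p = cofactors (vector ∘ rows ∘ punchIn p)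

      complement≢0 : ∀ rows p → det (vector ∘ rows) ≢ 0ℤ → ¬ (∀ c → complement rows p c ≡ 0ℤ)
      complement≢0 rows p det≢0 y≡0 =
        det≢0 (sign-cancel p (trans (sym (det-toFront p (vector ∘ rows))) (·-zeroʳ (vector (rows p)) y≡0)))

      finished : ∀ rows → det (vector ∘ rows) ≢ 0ℤ → (∀ i → ¬ IsUnit (rows i)) → NonsingularSelection
      finished rows det≢0 noUnit =
        proj₁ ∘ chosen , proj₂ ∘ chosen ,
        det≢0 ∘ trans (det-cong λ i j → cong (λ v → v j) (vector-selected (rows i) (noUnit i)))
        where
        chosen : Fin (suc m) → Σ (Fin K) A
        chosen i = selected (rows i) (noUnit i)

      -- A unit row is replaced by a row of S from A that is not orthogonal to the cofactors of the
      -- other rows, which keeps the determinant nonzero; if there is none, those cofactors will do.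
      mutual
        exchange : ∀ u rows → det (vector ∘ rows) ≢ 0ℤ → units rows ≡ u →
          NonsingularSelection ⊎ OrthogonalVector
        exchange u rows det≢0 #units with any? (isUnit? ∘ rows)
        ... | no noUnit = inj₁ (finished rows det≢0 (λ i unit → noUnit (i , unit)))
        ... | yes (p , unitAtP) = replaceUnit u rows det≢0 #units p unitAtP

        replaceUnit : ∀ u rows → det (vector ∘ rows) ≢ 0ℤ → units rows ≡ u → ∀ p → IsUnit (rows p) →
          NonsingularSelection ⊎ OrthogonalVector
        replaceUnit zero rows _ #units p unitAtP with () ← trans (sym (units-remove rows p unitAtP)) #units
        replaceUnit (suc u) rows det≢0 #units p unitAtP
          with any? (λ k → A? k ×-dec ¬? (S k · complement rows p ≟ 0ℤ))
        ... | yes (k , a , S·y≢0) =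
          exchange u (inj₁ (k , a) ∷ rows ∘ punchIn p) S·y≢0
                   (ℕP.suc-injective (trans (sym (units-remove rows p unitAtP)) #units))
        ... | no none = inj₂ (complement rows p , complement≢0 rows p det≢0 , λ k a →
          decidable-stable (S k · complement rows p ≟ 0ℤ) (λ S·y≢0 → none (k , a , S·y≢0)))

    nonsingularOrOrthogonal : NonsingularSelection ⊎ OrthogonalVector
    nonsingularOrOrthogonal = exchange (suc m) inj₂ det≢0 (units-unit (λ c → c))
      where
      det≢0 : det (vector ∘ inj₂) ≢ 0ℤ
      det≢0 det≡0 with () ← trans (sym (det-unit {suc m})) det≡0

module Cone where

  open Determinants
  open Exchange
  open Search using (least)
  open import Data.Nat as ℕ using (ℕ; zero; suc; _!)
  import Data.Nat.Properties as ℕP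
  open import Data.Nat.Induction using (<-wellFounded)
  open import Induction.WellFounded using (Acc; acc)
  open import Data.Fin using (Fin; zero; suc; punchIn)
  open import Data.Fin.Properties using (any?; ¬∀⟶∃¬)
  import Data.Fin.Properties as FinP
  open import Data.Vec.Functional using (Vector; _∷_)
  open import Data.Integer as ℤ using (ℤ; -_; _+_; _-_; _*_; 0ℤ; ∣_∣; _≤_; _<_)
  open import Data.Integer.Properties
  open import Data.Integer.Base using (positive; nonNegative)
  open import Data.Integer.Tactic.RingSolver using (solve-∀)
  import Algebra.Properties.Semiring.Sum ℕP.+-*-semiring as ℕΣ
  open import Data.Product using (Σ; ∃; _×_; _,_)
  open import Data.Sum using (inj₁; inj₂)
  open import Data.Unit using (⊤; tt)
  open import Function using (_∘_)
  open import Relation.Nullary using (Dec; yes; no; contradiction)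
  open import Relation.Binary.PropositionalEquality

  0≤* : ∀ {a b} → 0ℤ ≤ a → 0ℤ ≤ b → 0ℤ ≤ a * b
  0≤* {a} 0≤a 0≤b = subst (_≤ a * _) (*-zeroʳ a) (*-monoˡ-≤-nonNeg a {{nonNegative 0≤a}} 0≤b)

  0<* : ∀ {a b} → 0ℤ < a → 0ℤ < b → 0ℤ < a * b
  0<* {a} 0<a 0<b = subst (_< a * _) (*-zeroʳ a) (*-monoˡ-<-pos a {{positive 0<a}} 0<b)

  *-cancelˡ-≤ : ∀ {a b} c → 0ℤ < c → c * a ≤ c * b → a ≤ b
  *-cancelˡ-≤ {a} {b} c 0<c = *-cancelˡ-≤-pos a b c {{positive 0<c}}

  -- Transitivity of  a/b ≤ a'/b'  for positive denominators, with the division cleared.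
  cross-≤-trans : ∀ {a₁ a₂ a₃ b₁ b₂ b₃} → 0ℤ < b₁ → 0ℤ < b₂ → 0ℤ < b₃ →
    a₁ * b₂ ≤ a₂ * b₁ → a₂ * b₃ ≤ a₃ * b₂ → a₁ * b₃ ≤ a₃ * b₁
  cross-≤-trans {a₁} {a₂} {a₃} {b₁} {b₂} {b₃} 0<b₁ 0<b₂ 0<b₃ r₁₂ r₂₃ = *-cancelˡ-≤ b₂ 0<b₂ (begin
    b₂ * (a₁ * b₃)  ≡⟨ rearrange a₁ b₂ b₃ ⟩
    b₃ * (a₁ * b₂)  ≤⟨ *-monoˡ-≤-nonNeg b₃ {{nonNegative (<⇒≤ 0<b₃)}} r₁₂ ⟩
    b₃ * (a₂ * b₁)  ≡⟨ rearrange a₂ b₃ b₁ ⟩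
    b₁ * (a₂ * b₃)  ≤⟨ *-monoˡ-≤-nonNeg b₁ {{nonNegative (<⇒≤ 0<b₁)}} r₂₃ ⟩
    b₁ * (a₃ * b₂)  ≡⟨ rearrange a₃ b₁ b₂ ⟩
    b₂ * (a₃ * b₁)  ∎)
    where
    open ≤-Reasoning
    rearrange : ∀ a b c → b * (a * c) ≡ c * (a * b)
    rearrange = solve-∀

  nonzero : ℤ → ℕ
  nonzero x with x ≟ 0ℤ
  ... | yes _ = 0
  ... | no _ = 1

  nonzero-≡0 : ∀ {x} → x ≡ 0ℤ → nonzero x ≡ 0
  nonzero-≡0 refl = refl

  nonzero-≢0 : ∀ {x} → x ≢ 0ℤ → nonzero x ≡ 1
  nonzero-≢0 {x} x≢0 with x ≟ 0ℤ
  ... | yes x≡0 = contradiction x≡0 x≢0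
  ... | no _ = refl

  nonzero≤1 : ∀ x → nonzero x ℕ.≤ 1
  nonzero≤1 x with x ≟ 0ℤ
  ... | yes _ = ℕ.z≤n
  ... | no _ = ℕP.≤-refl

  sum-mono-≤ : ∀ {n} (f g : Fin n → ℕ) → (∀ i → f i ℕ.≤ g i) → ℕΣ.sum f ℕ.≤ ℕΣ.sum g
  sum-mono-≤ {zero} f g f≤g = ℕ.z≤n
  sum-mono-≤ {suc n} f g f≤g = ℕP.+-mono-≤ (f≤g zero) (sum-mono-≤ (f ∘ suc) (g ∘ suc) (f≤g ∘ suc))

  sum-mono-< : ∀ {n} (f g : Fin n → ℕ) → (∀ i → f i ℕ.≤ g i) → ∀ k → f k ℕ.< g k →
    ℕΣ.sum f ℕ.< ℕΣ.sum g
  sum-mono-< {suc n} f g f≤g zero fk<gk =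
    ℕP.+-mono-<-≤ fk<gk (sum-mono-≤ (f ∘ suc) (g ∘ suc) (f≤g ∘ suc))
  sum-mono-< {suc n} f g f≤g (suc k) fk<gk =
    ℕP.+-mono-≤-< (f≤g zero) (sum-mono-< (f ∘ suc) (g ∘ suc) (f≤g ∘ suc) k fk<gk)

  module _ {m K : ℕ} (ρ : Fin K → Vector ℤ (suc m)) where

    record Feasible (z : Vector ℤ (suc m)) : Set where
      constructor feasible
      field
        satisfies : ∀ k → 0ℤ ≤ ρ k · z
        leading-positive : 0ℤ < z zero

    Tight : Vector ℤ (suc m) → Fin K → Set
    Tight z k = ρ k · z ≡ 0ℤ

    slack : Vector ℤ (suc m) → ℕ
    slack z = ℕΣ.sum (λ k → nonzero (ρ k · z))

    Improvement : Vector ℤ (suc m) → Set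
    Improvement z = Σ (Vector ℤ (suc m)) λ z′ → Feasible z′ × slack z′ ℕ.< slack z

    -- The ratio test of the simplex method: move along d until a first new constraint becomes tight.
    module RatioTest {z : Vector ℤ (suc m)} (z-feasible : Feasible z) (d : Vector ℤ (suc m))
      (d₀≡0 : d zero ≡ 0ℤ) (d-keeps-tight : ∀ k → Tight z k → ρ k · d ≡ 0ℤ) where

      open Feasible z-feasible

      a b : Fin K → ℤ
      a k = ρ k · z
      b k = - (ρ k · d)

      Descending : Fin K → Set
      Descending k = ρ k · d < 0ℤ

      MinimalRatio : Fin K → Set
      MinimalRatio k* = ∀ k → Descending k → a k* * b k ≤ a k * b k*

      minimalRatio : ∃ Descending → Σ (Fin K) λ k* → Descending k* × MinimalRatio k*
      minimalRatio = least (λ k → ρ k · d <? 0ℤ) (λ i j → a i * b j ≤ a j * b i)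
        (λ i j → ≤-total (a i * b j) (a j * b i))
        (λ {i} {j} {l} di dj dl → cross-≤-trans {a i} {a j} {a l} (neg-mono-< di) (neg-mono-< dj) (neg-mono-< dl))

      module _ (k* : Fin K) (k*-descending : Descending k*) (k*-minimal : MinimalRatio k*) where

        z′ : Vector ℤ (suc m)
        z′ c = b k* * z c + a k* * d c

        ρz′ : ∀ k → ρ k · z′ ≡ b k* * a k + a k* * (ρ k · d)
        ρz′ k = ·-linearʳ (ρ k) z d (b k*) (a k*)

        z′-feasible : Feasible z′
        z′-feasible = feasible ρz′≥0 z′₀>0
          where
          ρz′≥0 : ∀ k → 0ℤ ≤ ρ k · z′
          ρz′≥0 k with ρ k · d <? 0ℤ
          ... | yes descending = subst (0ℤ ≤_) (trans (unfold (a k) (ρ k · d) (a k*) (b k*)) (sym (ρz′ k)))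
                                       (i≤j⇒0≤j-i (k*-minimal k descending))
            where
            unfold : ∀ x y A B → x * B - A * (- y) ≡ B * x + A * y
            unfold = solve-∀
          ... | no ρd≮0 = subst (0ℤ ≤_) (sym (ρz′ k)) (+-mono-≤ {0ℤ} {_} {0ℤ}
            (0≤* (<⇒≤ (neg-mono-< k*-descending)) (satisfies k)) (0≤* (satisfies k*) (≮⇒≥ ρd≮0)))
          z′₀>0 : 0ℤ < z′ zero
          z′₀>0 = subst (0ℤ <_) (sym (trans (cong (λ t → b k* * z zero + a k* * t) d₀≡0)
                                            (trans (cong (b k* * z zero +_) (*-zeroʳ (a k*))) (+-identityʳ _))))
                                (0<* (neg-mono-< k*-descending) leading-positive)

        slack-decreases : slack z′ ℕ.< slack z
        slack-decreases = sum-mono-< _ _ tight-stays k*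
          (subst₂ ℕ._<_ (sym (nonzero-≡0 k*-becomes-tight)) (sym (nonzero-≢0 k*-was-slack)) ℕP.0<1+n)
          where
          open ≡-Reasoning
          tight-stays : ∀ k → nonzero (ρ k · z′) ℕ.≤ nonzero (a k)
          tight-stays k with a k ≟ 0ℤ
          ... | yes tight = ℕP.≤-reflexive (nonzero-≡0 (begin
            ρ k · z′
              ≡⟨ ρz′ k ⟩
            b k* * a k + a k* * (ρ k · d)
              ≡⟨ cong₂ (λ u v → b k* * u + a k* * v) tight (d-keeps-tight k tight) ⟩
            b k* * 0ℤ + a k* * 0ℤ
              ≡⟨ cong₂ _+_ (*-zeroʳ (b k*)) (*-zeroʳ (a k*)) ⟩
            0ℤ ∎))
          ... | no _ = nonzero≤1 (ρ k · z′)
          k*-becomes-tight : ρ k* · z′ ≡ 0ℤ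
          k*-becomes-tight = trans (ρz′ k*) (cancel (a k*) (ρ k* · d))
            where
            cancel : ∀ x y → (- y) * x + x * y ≡ 0ℤ
            cancel = solve-∀
          k*-was-slack : a k* ≢ 0ℤ
          k*-was-slack tight = <-irrefl (d-keeps-tight k* tight) k*-descending

    ratioTest : ∀ {z} → Feasible z → ∀ d → d zero ≡ 0ℤ → (∀ k → Tight z k → ρ k · d ≡ 0ℤ) →
      ∀ k₀ → ρ k₀ · d < 0ℤ → Improvement z
    ratioTest z-feasible d d₀≡0 d-keeps-tight k₀ ρd<0 =
      let k* , descending , minimal = minimalRatio (k₀ , ρd<0)
      in z′ k* descending minimal , z′-feasible k* descending minimal , slack-decreases k* descending minimal
      where open RatioTest z-feasible d d₀≡0 d-keeps-tight

    Bounded : Vector ℤ (suc m) → Set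
    Bounded z = ∀ c → ∣ z c ∣ ℕ.≤ m !

    BoundedFeasiblePoint : Set
    BoundedFeasiblePoint = Σ (Vector ℤ (suc m)) λ z′ → Feasible z′ × Bounded z′

    feasible-proportional : ∀ {z y} → Feasible z → (∀ c → y zero * z c ≡ z zero * y c) → 0ℤ < y zero →
      Feasible y
    feasible-proportional {z} {y} (feasible ρz≥0 z₀>0) y₀z≡z₀y y₀>0 = feasible ρy≥0 y₀>0
      where
      open ≤-Reasoning
      ρy≥0 : ∀ k → 0ℤ ≤ ρ k · y
      ρy≥0 k = *-cancelˡ-≤ (z zero) z₀>0 (begin
        z zero * 0ℤ                  ≡⟨ *-zeroʳ (z zero) ⟩
        0ℤ                           ≤⟨ 0≤* (<⇒≤ y₀>0) (ρz≥0 k) ⟩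
        y zero * (ρ k · z)           ≡⟨ ·-scaleʳ (ρ k) z (y zero) ⟨
        ρ k · (λ c → y zero * z c)   ≡⟨ ·-congʳ (ρ k) y₀z≡z₀y ⟩
        ρ k · (λ c → z zero * y c)   ≡⟨ ·-scaleʳ (ρ k) y (z zero) ⟩
        z zero * (ρ k · y)           ∎)

    -- Row 0, the constraint z₀ ≥ 0, counts as active although z₀ > 0: vectors orthogonal to the
    -- active rows then keep z₀ fixed, and a nonsingular active system determines z up to scaling.
    rows⁺ : Fin (suc K) → Vector ℤ (suc m)
    rows⁺ = unit zero ∷ ρ

    Active : Vector ℤ (suc m) → Fin (suc K) → Set
    Active z zero = ⊤
    Active z (suc k) = Tight z k

    active? : ∀ z i → Dec (Active z i)
    active? z zero = yes tt
    active? z (suc k) = ρ k · z ≟ 0ℤ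

    active-tight : ∀ {z} i → i ≢ zero → Active z i → rows⁺ i · z ≡ 0ℤ
    active-tight zero i≢0 _ = contradiction refl i≢0
    active-tight (suc k) _ tight = tight

    module Vertex (ternary : Ternary ρ) {z : Vector ℤ (suc m)} (z-feasible : Feasible z)
      (idx : Fin (suc m) → Fin (suc K))
      (active : ∀ i → Active z (idx i)) (det≢0 : det (rows⁺ ∘ idx) ≢ 0ℤ) where

      L : Matrix (suc m) (suc m)
      L = rows⁺ ∘ idx

      -- Row p of L is the unit row; the remaining rows determine z up to scaling by their cofactors.
      module _ (p : Fin (suc m)) (idx[p]≡0 : idx p ≡ zero) where

        y : Vector ℤ (suc m)
        y = cofactors (L ∘ punchIn p)

        L[p]·v≡v₀ : ∀ v → L p · v ≡ v zero
        L[p]·v≡v₀ v = trans (cong (λ j → rows⁺ j · v) idx[p]≡0) (unit·y≡y zero v)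

        det-front≢0 : det (L ∘ toFront p) ≢ 0ℤ
        det-front≢0 det≡0 = det≢0 (sign-cancel p (trans (sym (det-toFront p L)) det≡0))

        y₀≢0 : y zero ≢ 0ℤ
        y₀≢0 y₀≡0 = det-front≢0 (trans (L[p]·v≡v₀ y) y₀≡0)

        others-tight : ∀ i → L (punchIn p i) · z ≡ 0ℤ
        others-tight i with idx (punchIn p i) FinP.≟ zero
        ... | yes idx≡0 = contradiction (trans (sym (trans (cong (λ j → rows⁺ j · y) idx≡0) (unit·y≡y zero y)))
                                               (cofactors-orthogonal (L ∘ punchIn p) i)) y₀≢0
        ... | no idx≢0 = active-tight {z} (idx (punchIn p i)) idx≢0 (active (punchIn p i))

        y₀z≡z₀y : ∀ c → y zero * z c ≡ z zero * y c
        y₀z≡z₀y c = i-j≡0⇒i≡j (y zero * z c) (z zero * y c)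
          (trans (cong (y zero * z c +_) (neg-distribˡ-* (z zero) (y c)))
                 (det≢0⇒kernel-trivial (L ∘ toFront p) {v} det-front≢0 kills c))
          where
          v : Vector ℤ (suc m)
          v c = y zero * z c + (- z zero) * y c
          kills : ∀ i → (L ∘ toFront p) i · v ≡ 0ℤ
          kills zero = trans (L[p]·v≡v₀ v) (cancel (y zero) (z zero))
            where
            cancel : ∀ a b → a * b + (- b) * a ≡ 0ℤ
            cancel = solve-∀
          kills (suc i) = begin
            L (punchIn p i) · v
              ≡⟨ ·-linearʳ (L (punchIn p i)) z y (y zero) (- z zero) ⟩
            y zero * (L (punchIn p i) · z) + (- z zero) * (L (punchIn p i) · y)
              ≡⟨ cong₂ (λ s t → y zero * s + (- z zero) * t)
                       (others-tight i) (cofactors-orthogonal (L ∘ punchIn p) i) ⟩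
            y zero * 0ℤ + (- z zero) * 0ℤ
              ≡⟨ cong₂ _+_ (*-zeroʳ (y zero)) (*-zeroʳ (- z zero)) ⟩
            0ℤ ∎
            where open ≡-Reasoning

        y-bounded : Bounded y
        y-bounded = ∣cofactors∣≤! (L ∘ punchIn p) (λ i → rows⁺-ternary (idx (punchIn p i)))
          where
          rows⁺-ternary : ∀ i j → ∣ rows⁺ i j ∣ ℕ.≤ 1
          rows⁺-ternary zero = unit-ternary zero
          rows⁺-ternary (suc k) = ternary k

        orient : BoundedFeasiblePoint
        orient with 0ℤ <? y zero
        ... | yes y₀>0 = y , feasible-proportional z-feasible y₀z≡z₀y y₀>0 , y-bounded
        ... | no y₀≯0 =
          -y , feasible-proportional z-feasible -y₀z≡z₀-y (neg-mono-< (≤∧≢⇒< (≮⇒≥ y₀≯0) y₀≢0)) ,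
          λ c → subst (ℕ._≤ m !) (sym (∣-i∣≡∣i∣ (y c))) (y-bounded c)
          where
          -y : Vector ℤ (suc m)
          -y c = - y c
          -y₀z≡z₀-y : ∀ c → - y zero * z c ≡ z zero * - y c
          -y₀z≡z₀-y c = trans (sym (neg-distribˡ-* (y zero) (z c)))
                              (trans (cong -_ (y₀z≡z₀y c)) (neg-distribʳ-* (z zero) (y c)))

      boundedFeasible : BoundedFeasiblePoint
      boundedFeasible with any? (λ i → idx i FinP.≟ zero)
      ... | no noUnitRow = contradiction (sym (det≢0⇒kernel-trivial L {z} det≢0 all-tight zero))
                                         (<⇒≢ (Feasible.leading-positive z-feasible))
        where
        all-tight : ∀ i → L i · z ≡ 0ℤ
        all-tight i = active-tight {z} (idx i) (noUnitRow ∘ (i ,_)) (active i)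
      ... | yes (p , idx[p]≡0) = orient p idx[p]≡0

    module _ (spanning : ∀ y → y zero ≡ 0ℤ → (∀ k → ρ k · y ≡ 0ℤ) → ∀ c → y c ≡ 0ℤ) where

      reduceSlack : ∀ {z} → Feasible z → OrthogonalVector rows⁺ (active? z) → Improvement z
      reduceSlack {z} z-feasible (y , y≢0 , y⊥active) =
        along (¬∀⟶∃¬ K (λ k → ρ k · y ≡ 0ℤ) (λ k → ρ k · y ≟ 0ℤ) (y≢0 ∘ spanning y y₀≡0))
        where
        y₀≡0 : y zero ≡ 0ℤ
        y₀≡0 = trans (sym (unit·y≡y zero y)) (y⊥active zero tt)
        along : ∃ (λ k → ρ k · y ≢ 0ℤ) → Improvement z
        along (k₀ , ρy≢0) with ρ k₀ · y <? 0ℤ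
        ... | yes ρy<0 = ratioTest z-feasible y y₀≡0 (λ k → y⊥active (suc k)) k₀ ρy<0
        ... | no ρy≮0 = ratioTest z-feasible (λ c → - y c) (cong -_ y₀≡0)
          (λ k tight → trans (·-negʳ (ρ k) y) (cong -_ (y⊥active (suc k) tight))) k₀
          (subst (_< 0ℤ) (sym (·-negʳ (ρ k₀) y)) (neg-mono-< (≤∧≢⇒< (≮⇒≥ ρy≮0) (ρy≢0 ∘ sym))))

      boundedFeasiblePoint : Ternary ρ → ∀ {z} → Feasible z → BoundedFeasiblePoint
      boundedFeasiblePoint ternary {z} z-feasible = descend z-feasible (<-wellFounded (slack z))
        where
        descend : ∀ {z} → Feasible z → Acc ℕ._<_ (slack z) → BoundedFeasiblePoint
        descend {z} z-feasible (acc smaller) with nonsingularOrOrthogonal rows⁺ (active? z)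
        ... | inj₁ (idx , active , det≢0) = Vertex.boundedFeasible ternary z-feasible idx active det≢0
        ... | inj₂ orthogonal with reduceSlack z-feasible orthogonal
        ...   | z′ , feasible′ , z′<z = descend feasible′ (smaller z′<z)

module Threshold where

  open Determinants using (_·_; ·-congˡ)
  open import Data.Bool using (Bool; true; false)
  open import Data.Vec using (Vec; []; _∷_; lookup; tabulate)
  open import Data.Vec.Properties using (lookup∘tabulate)
  open import Data.Vec.Functional using (Vector)
  open import Data.Nat as ℕ using ()
  open import Data.Integer using (ℤ; _+_; _*_; _≤_; _<_; ∣_∣)
  open import Data.Integer.Properties using (_<?_; ≮⇒≥; <⇒≱)
  open import Relation.Nullary using (yes; no; contradiction)
  open import Relation.Binary.PropositionalEquality

  bits : ∀ {n} → BVec n → Vector ℤ n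
  bits X i = bitℤ (lookup X i)

  ∣bitℤ∣≤1 : ∀ x → ∣ bitℤ x ∣ ℕ.≤ 1
  ∣bitℤ∣≤1 true = ℕ.s≤s ℕ.z≤n
  ∣bitℤ∣≤1 false = ℕ.z≤n

  dotℤ≡· : ∀ {n} (w : Vec ℤ n) X → dotℤ w X ≡ lookup w · bits X
  dotℤ≡· [] [] = refl
  dotℤ≡· (w ∷ ws) (x ∷ xs) = cong (w * bitℤ x +_) (dotℤ≡· ws xs)

  dotℤ-tabulate : ∀ {n} (v : Vector ℤ n) X → dotℤ (tabulate v) X ≡ v · bits X
  dotℤ-tabulate v X = trans (dotℤ≡· (tabulate v) X) (·-congˡ (bits X) (lookup∘tabulate v))

  module _ {n} (w : Vec ℤ n) (b : ℤ) (X : BVec n) where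

    LTF-true : b ≤ dotℤ w X → LTF w b X ≡ true
    LTF-true b≤w·X with dotℤ w X <? b
    ... | yes w·X<b = contradiction b≤w·X (<⇒≱ w·X<b)
    ... | no _ = refl

    LTF-false : dotℤ w X < b → LTF w b X ≡ false
    LTF-false w·X<b with dotℤ w X <? b
    ... | yes _ = refl
    ... | no w·X≮b = contradiction w·X<b w·X≮b

    LTF≡true⇒ : LTF w b X ≡ true → b ≤ dotℤ w X
    LTF≡true⇒ fX≡true with dotℤ w X <? b
    ... | no w·X≮b = ≮⇒≥ w·X≮b

    LTF≡false⇒ : LTF w b X ≡ false → dotℤ w X < b
    LTF≡false⇒ fX≡false with dotℤ w X <? b
    ... | yes w·X<b = w·X<b

module SmallWeights where

  open Determinants
  open Cone
  open Search using (cardinality; enumerate; enumerate-surjective)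
  open Threshold
  open import Data.Nat as ℕ using (ℕ; zero; suc; _!)
  import Data.Nat.Properties as ℕP
  open import Data.Fin using (Fin; zero; suc)
  open import Data.Bool using (Bool; true; false)
  open import Data.Vec using (Vec; _∷_; lookup; tabulate; replicate)
  open import Data.Vec.Properties using (lookup∘tabulate; lookup-replicate)
  open import Data.Vec.Functional using (Vector)
  open import Data.Integer as ℤ using (ℤ; -_; _+_; _-_; _*_; 0ℤ; 1ℤ; -1ℤ; ∣_∣; _≤_; _<_)
  open import Data.Integer.Properties
  open import Data.Integer.Tactic.RingSolver using (solve-∀)
  open import Algebra.Properties.Semiring.Sum +-*-semiring using (sum; sum-cong-≗; *-distribˡ-sum)
  open import Data.Product using (Σ; _×_; _,_)
  open import Relation.Binary.PropositionalEquality

  margin : ∀ {n} → Vector ℤ (suc (suc n)) → ℤ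
  margin z = z zero

  threshold : ∀ {n} → Vector ℤ (suc (suc n)) → ℤ
  threshold z = z (suc zero)

  weights : ∀ {n} → Vector ℤ (suc (suc n)) → Vector ℤ n
  weights z i = z (suc (suc i))

  ±1 : Bool → ℤ
  ±1 true = 1ℤ
  ±1 false = -1ℤ

  -- The constraint  ±1 s * (weights · X − threshold) ≥ margin  of input X with value s; for a positive
  -- margin it says that the threshold function with these weights and threshold + 1 is s at X.
  constraint : ∀ {n} → Bool → BVec n → Vector ℤ (suc (suc n))
  constraint s X zero = -1ℤ
  constraint s X (suc zero) = - ±1 s
  constraint s X (suc (suc i)) = ±1 s * bits X i

  constraint·z : ∀ {n} s (X : BVec n) z → constraint s X · z ≡ ±1 s * (weights z · bits X - threshold z) - margin z
  constraint·z s X z = begin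
    -1ℤ * margin z + (- ±1 s * threshold z + sum (λ i → ±1 s * bits X i * weights z i))
      ≡⟨ cong (λ t → -1ℤ * margin z + (- ±1 s * threshold z + t))
              (trans (sum-cong-≗ (λ i → reorder (±1 s) (bits X i) (weights z i)))
                     (sym (*-distribˡ-sum (±1 s) (λ i → weights z i * bits X i)))) ⟩
    -1ℤ * margin z + (- ±1 s * threshold z + ±1 s * (weights z · bits X))
      ≡⟨ collect (±1 s) (margin z) (threshold z) (weights z · bits X) ⟩
    ±1 s * (weights z · bits X - threshold z) - margin z ∎
    where
    open ≡-Reasoning
    reorder : ∀ s x w → s * x * w ≡ s * (w * x)
    reorder = solve-∀
    collect : ∀ s z₀ z₁ t → -1ℤ * z₀ + (- s * z₁ + s * t) ≡ s * (t - z₁) - z₀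
    collect = solve-∀

  ∣±1∣≡1 : ∀ s → ∣ ±1 s ∣ ≡ 1
  ∣±1∣≡1 true = refl
  ∣±1∣≡1 false = refl

  ±1*x≡0⇒x≡0 : ∀ s {x} → ±1 s * x ≡ 0ℤ → x ≡ 0ℤ
  ±1*x≡0⇒x≡0 true {x} eq = trans (sym (*-identityˡ x)) eq
  ±1*x≡0⇒x≡0 false {x} eq = trans (sym (neg-involutive x)) (cong -_ (trans (sym (-1*i≡-i x)) eq))

  oneHot : ∀ {n} → Fin n → BVec n
  oneHot {suc n} zero = true ∷ replicate n false
  oneHot (suc i) = false ∷ oneHot i

  bits-oneHot : ∀ {n} (i j : Fin n) → bits (oneHot i) j ≡ unit i j
  bits-oneHot zero zero = refl
  bits-oneHot {suc n} zero (suc j) = cong bitℤ (lookup-replicate j false)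
  bits-oneHot (suc i) zero = refl
  bits-oneHot (suc i) (suc j) = bits-oneHot i j

  bits-allFalse : ∀ {n} (j : Fin n) → bits (replicate n false) j ≡ 0ℤ
  bits-allFalse j = cong bitℤ (lookup-replicate j false)

  module ConeOf {n} (f : BVec n → Bool) where

    ρ : Fin (cardinality n) → Vector ℤ (suc (suc n))
    ρ k = constraint (f (enumerate k)) (enumerate k)

    ternary : Ternary ρ
    ternary k zero = ℕP.≤-refl
    ternary k (suc zero) = ℕP.≤-reflexive (trans (∣-i∣≡∣i∣ (±1 (f X))) (∣±1∣≡1 (f X)))
      where
      X : BVec n
      X = enumerate k
    ternary k (suc (suc i)) = ℕP.≤-trans (ℕP.≤-reflexive (abs-* (±1 (f X)) (bits X i)))
      (ℕP.*-mono-≤ (ℕP.≤-reflexive (∣±1∣≡1 (f X))) (∣bitℤ∣≤1 (lookup X i)))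
      where
      X : BVec n
      X = enumerate k

    every-constraint : ∀ {P : Vector ℤ (suc (suc n)) → Set} → (∀ k → P (ρ k)) → ∀ X → P (constraint (f X) X)
    every-constraint {P} Pρ X with enumerate-surjective X
    ... | k , refl = Pρ k

    spanning : ∀ y → margin y ≡ 0ℤ → (∀ k → ρ k · y ≡ 0ℤ) → ∀ c → y c ≡ 0ℤ
    spanning y y₀≡0 ρy≡0 = coordinates
      where
      weights·X≡threshold : ∀ X → weights y · bits X ≡ threshold y
      weights·X≡threshold X = i-j≡0⇒i≡j (weights y · bits X) (threshold y) (±1*x≡0⇒x≡0 (f X) (begin
        gap               ≡⟨ +-identityʳ gap ⟨
        gap - 0ℤ          ≡⟨ cong (λ t → gap - t) y₀≡0 ⟨
        gap - margin y    ≡⟨ constraint·z (f X) X y ⟨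
        constraint (f X) X · y  ≡⟨ every-constraint {λ r → r · y ≡ 0ℤ} ρy≡0 X ⟩
        0ℤ                ∎))
        where
        open ≡-Reasoning
        gap : ℤ
        gap = ±1 (f X) * (weights y · bits X - threshold y)
      threshold≡0 : threshold y ≡ 0ℤ
      threshold≡0 = trans (sym (weights·X≡threshold (replicate n false))) (·-zeroʳ (weights y) bits-allFalse)
      coordinates : ∀ c → y c ≡ 0ℤ
      coordinates zero = y₀≡0
      coordinates (suc zero) = threshold≡0
      coordinates (suc (suc i)) = begin
        weights y i                    ≡⟨ unit·y≡y i (weights y) ⟨
        unit i · weights y             ≡⟨ ·-comm (unit i) (weights y) ⟩
        weights y · unit i             ≡⟨ ·-congʳ (weights y) (bits-oneHot i) ⟨
        weights y · bits (oneHot i)    ≡⟨ weights·X≡threshold (oneHot i) ⟩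
        threshold y                    ≡⟨ threshold≡0 ⟩
        0ℤ                             ∎
        where open ≡-Reasoning

  private
    0≤x+x : ∀ {x} → 0ℤ ≤ x → 0ℤ ≤ x + x
    0≤x+x 0≤x = +-mono-≤ {0ℤ} {_} {0ℤ} 0≤x 0≤x

    initial-true : ∀ {d b} → b ≤ d → 0ℤ ≤ ±1 true * ((d + d) - (b + b - 1ℤ)) - 1ℤ
    initial-true {d} {b} b≤d = subst (0ℤ ≤_) (expand d b) (0≤x+x (i≤j⇒0≤j-i b≤d))
      where
      expand : ∀ d b → d - b + (d - b) ≡ 1ℤ * ((d + d) - (b + b - 1ℤ)) - 1ℤ
      expand = solve-∀

    initial-false : ∀ {d b} → d < b → 0ℤ ≤ ±1 false * ((d + d) - (b + b - 1ℤ)) - 1ℤ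
    initial-false {d} {b} d<b = subst (0ℤ ≤_) (expand d b) (0≤x+x (i≤j⇒0≤j-i (i<j⇒suc[i]≤j d<b)))
      where
      expand : ∀ d b → b - (1ℤ + d) + (b - (1ℤ + d)) ≡ -1ℤ * ((d + d) - (b + b - 1ℤ)) - 1ℤ
      expand = solve-∀

    above-threshold : ∀ {t z₁ z₀} → 0ℤ ≤ ±1 true * (t - z₁) - z₀ → 0ℤ < z₀ → z₁ + 1ℤ ≤ t
    above-threshold {t} {z₁} {z₀} 0≤gap 0<z₀ =
      0≤i-j⇒j≤i (subst (0ℤ ≤_) (collect t z₁ z₀)
        (+-mono-≤ {0ℤ} {_} {0ℤ} (i≤j⇒0≤j-i (i<j⇒suc[i]≤j 0<z₀)) 0≤gap))
      where
      collect : ∀ t z₁ z₀ → z₀ - (1ℤ + 0ℤ) + (1ℤ * (t - z₁) - z₀) ≡ t - (z₁ + 1ℤ)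
      collect = solve-∀

    below-threshold : ∀ {t z₁ z₀} → 0ℤ ≤ ±1 false * (t - z₁) - z₀ → 0ℤ < z₀ → t < z₁ + 1ℤ
    below-threshold {t} {z₁} {z₀} 0≤gap 0<z₀ =
      suc[i]≤j⇒i<j (0≤i-j⇒j≤i (subst (0ℤ ≤_) (collect t z₁ z₀)
        (+-mono-≤ {0ℤ} {_} {0ℤ} (<⇒≤ 0<z₀) 0≤gap)))
      where
      collect : ∀ t z₁ z₀ → z₀ + (-1ℤ * (t - z₁) - z₀) ≡ (z₁ + 1ℤ) - (1ℤ + t)
      collect = solve-∀

  module _ {n} (w : Vec ℤ n) (b : ℤ) where

    open ConeOf (LTF w b)

    doubled : Vector ℤ (suc (suc n))
    doubled zero = 1ℤ
    doubled (suc zero) = b + b - 1ℤ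
    doubled (suc (suc i)) = lookup w i + lookup w i

    doubled-feasible : Feasible ρ doubled
    doubled-feasible = feasible (λ k → satisfied (enumerate k)) (ℤ.+<+ ℕ.z<s)
      where
      gap : ∀ s X → constraint s X · doubled ≡ ±1 s * ((dotℤ w X + dotℤ w X) - (b + b - 1ℤ)) - 1ℤ
      gap s X = trans (constraint·z s X doubled) (cong (λ t → ±1 s * (t - (b + b - 1ℤ)) - 1ℤ)
        (trans (·-distribʳ-+ (lookup w) (lookup w) (bits X)) (sym (cong₂ _+_ (dotℤ≡· w X) (dotℤ≡· w X)))))
      satisfied : ∀ X → 0ℤ ≤ constraint (LTF w b X) X · doubled
      satisfied X with LTF w b X in fX
      ... | true = subst (0ℤ ≤_) (sym (gap true X)) (initial-true (LTF≡true⇒ w b X fX))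
      ... | false = subst (0ℤ ≤_) (sym (gap false X)) (initial-false (LTF≡false⇒ w b X fX))

    realised : ∀ {z} → Feasible ρ z → ∀ X → LTF (tabulate (weights z)) (threshold z + 1ℤ) X ≡ LTF w b X
    realised {z} (feasible satisfies z₀>0) X with LTF w b X | every-constraint {λ r → 0ℤ ≤ r · z} satisfies X
    ... | true | sat = LTF-true (tabulate (weights z)) (threshold z + 1ℤ) X
      (subst (threshold z + 1ℤ ≤_) (sym (dotℤ-tabulate (weights z) X))
             (above-threshold (subst (0ℤ ≤_) (constraint·z true X z) sat) z₀>0))
    ... | false | sat = LTF-false (tabulate (weights z)) (threshold z + 1ℤ) X
      (subst (_< threshold z + 1ℤ) (sym (dotℤ-tabulate (weights z) X))
             (below-threshold (subst (0ℤ ≤_) (constraint·z false X z) sat) z₀>0))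

    smallWeights : Σ (Vec ℤ n) λ w′ → Σ ℤ λ b′ →
      (∀ X → LTF w′ b′ X ≡ LTF w b X) × (∀ i → ∣ lookup w′ i ∣ ℕ.≤ suc n !)
    smallWeights with boundedFeasiblePoint ρ spanning ternary doubled-feasible
    ... | z , z-feasible , bounded = tabulate (weights z) , threshold z + 1ℤ , realised z-feasible ,
      λ i → subst (λ x → ∣ x ∣ ℕ.≤ suc n !) (sym (lookup∘tabulate (weights z) i)) (bounded (suc (suc i)))

module Rationals where

  open import Data.Nat as ℕ using (ℕ; suc; NonZero)
  import Data.Nat.Properties as ℕP
  open import Data.Nat.GCD using (gcd[m,n]≡0⇒n≡0) renaming (gcd to gcdℕ)
  open import Data.Integer as ℤ using (ℤ; ∣_∣; 1ℤ)
  import Data.Integer.Properties as ℤP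
  open import Data.Integer.GCD using (gcd)
  import Data.Integer.GCD as ℤGCD
  open import Data.Integer.Tactic.RingSolver using (solve-∀)
  open import Data.Rational as ℚ using (ℚ; _/_; ↥_; ↧_; ↧ₙ_)
  import Data.Rational.Properties as ℚP
  open import Data.Rational.Unnormalised as ℚᵘ using (mkℚᵘ; *≡*; *<*)
  import Data.Rational.Unnormalised.Properties as ℚᵘP
  open import Data.Bool using (Bool; true; false)
  open import Relation.Binary.PropositionalEquality

  ι : ℤ → ℚ
  ι a = a / 1

  private
    toℚᵘ-ι : ∀ a → ℚ.toℚᵘ (ι a) ℚᵘ.≃ mkℚᵘ a 0
    toℚᵘ-ι a = ℚP.toℚᵘ-fromℚᵘ (mkℚᵘ a 0)

  ι-+ : ∀ a b → ι (a ℤ.+ b) ≡ ι a ℚ.+ ι b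
  ι-+ a b = ℚP.toℚᵘ-injective (ℚᵘP.≃-trans (toℚᵘ-ι (a ℤ.+ b)) (ℚᵘP.≃-sym
    (ℚᵘP.≃-trans (ℚP.toℚᵘ-homo-+ (ι a) (ι b))
    (ℚᵘP.≃-trans (ℚᵘP.+-cong (toℚᵘ-ι a) (toℚᵘ-ι b)) (*≡* (cross a b))))))
    where
    cross : ∀ a b → (a ℤ.* 1ℤ ℤ.+ b ℤ.* 1ℤ) ℤ.* 1ℤ ≡ (a ℤ.+ b) ℤ.* 1ℤ
    cross = solve-∀

  ι-* : ∀ a b → ι (a ℤ.* b) ≡ ι a ℚ.* ι b
  ι-* a b = ℚP.toℚᵘ-injective (ℚᵘP.≃-trans (toℚᵘ-ι (a ℤ.* b)) (ℚᵘP.≃-sym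
    (ℚᵘP.≃-trans (ℚP.toℚᵘ-homo-* (ι a) (ι b))
    (ℚᵘP.≃-trans (ℚᵘP.*-cong (toℚᵘ-ι a) (toℚᵘ-ι b)) (*≡* refl)))))

  ι-neg : ∀ a → ι (ℤ.- a) ≡ ℚ.- ι a
  ι-neg a = ℚP.toℚᵘ-injective (ℚᵘP.≃-trans (toℚᵘ-ι (ℤ.- a)) (ℚᵘP.≃-sym
    (ℚᵘP.≃-trans (ℚP.toℚᵘ-homo‿- (ι a))
    (ℚᵘP.≃-trans (ℚᵘP.-‿cong (toℚᵘ-ι a)) (*≡* refl)))))

  ι-minus : ∀ a b → ι (a ℤ.- b) ≡ ι a ℚ.- ι b
  ι-minus a b = trans (ι-+ a (ℤ.- b)) (cong (ι a ℚ.+_) (ι-neg b))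

  ι-mono-< : ∀ {a b} → a ℤ.< b → ι a ℚ.< ι b
  ι-mono-< {a} {b} a<b = ℚP.toℚᵘ-cancel-<
    (ℚᵘP.<-respˡ-≃ (ℚᵘP.≃-sym (toℚᵘ-ι a)) (ℚᵘP.<-respʳ-≃ (ℚᵘP.≃-sym (toℚᵘ-ι b))
    (*<* (subst₂ ℤ._<_ (sym (ℤP.*-identityʳ a)) (sym (ℤP.*-identityʳ b)) a<b))))

  ι[d]*[N/d]≡ι[N] : ∀ N d .{{_ : NonZero d}} → ι (ℤ.+ d) ℚ.* (N / d) ≡ ι N
  ι[d]*[N/d]≡ι[N] N d@(suc d-1) = ℚP.toℚᵘ-injective (ℚᵘP.≃-trans (ℚP.toℚᵘ-homo-* (ι (ℤ.+ d)) (N / d))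
    (ℚᵘP.≃-trans (ℚᵘP.*-cong (toℚᵘ-ι (ℤ.+ d)) (ℚP.toℚᵘ-fromℚᵘ (mkℚᵘ N d-1)))
    (ℚᵘP.≃-trans (*≡* cross) (ℚᵘP.≃-sym (toℚᵘ-ι N)))))
    where
    cancel : ∀ a b → (a ℤ.* b) ℤ.* 1ℤ ≡ b ℤ.* a
    cancel = solve-∀
    cross : (ℤ.+ d ℤ.* N) ℤ.* 1ℤ ≡ N ℤ.* ℤ.+ suc (d-1 ℕ.+ 0)
    cross rewrite ℕP.+-identityʳ d-1 = cancel (ℤ.+ d) N

  bitℚ≡ι : ∀ x → bitℚ x ≡ ι (bitℤ x)
  bitℚ≡ι true = refl
  bitℚ≡ι false = refl

  ↥[N/1]≡N : ∀ N → ↥ (N / 1) ≡ N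
  ↥[N/1]≡N N = trans (sym (ℤP.*-identityʳ (↥ (N / 1))))
                     (trans (cong (↥ (N / 1) ℤ.*_) (sym (ℤGCD.gcd-zeroʳ N))) (ℚP.↥-/ N 1))

  module _ (N : ℤ) (d : ℕ) .{{_ : NonZero d}} where

    private
      g : ℕ
      g = gcdℕ ∣ N ∣ d

      instance
        g≢0 : NonZero g
        g≢0 = ℕ.≢-nonZero λ g≡0 → ℕ.≢-nonZero⁻¹ d (gcd[m,n]≡0⇒n≡0 ∣ N ∣ g≡0)

    ∣↥[N/d]∣≤∣N∣ : ∣ ↥ (N / d) ∣ ℕ.≤ ∣ N ∣
    ∣↥[N/d]∣≤∣N∣ = subst (∣ ↥ (N / d) ∣ ℕ.≤_)
      (trans (sym (ℤP.abs-* (↥ (N / d)) (gcd N (ℤ.+ d)))) (cong ∣_∣ (ℚP.↥-/ N d)))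
      (ℕP.m≤m*n ∣ ↥ (N / d) ∣ g)

    ↧ₙ[N/d]≤d : ↧ₙ (N / d) ℕ.≤ d
    ↧ₙ[N/d]≤d = subst (↧ₙ (N / d) ℕ.≤_)
      (trans (sym (ℤP.abs-* (↧ (N / d)) (gcd N (ℤ.+ d)))) (cong ∣_∣ (ℚP.↧-/ N d)))
      (ℕP.m≤m*n (↧ₙ (N / d)) g)

module Resolution where

  open Rationals
  open import Data.Nat as ℕ using (ℕ; zero; suc; NonZero; _≤_; _<_; _+_; _^_; ⌈_/2⌉; z≤n; s≤s)
  open import Data.Nat.Properties
  open import Data.Nat.Induction using (<-rec)
  open import Data.Nat.Logarithm using (⌈log₂_⌉; ⌈log₂⌉-mono-≤; ⌈log₂2^n⌉≡n; ⌈log₂⌈n/2⌉⌉≡⌈log₂n⌉∸1)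
  open import Data.Fin using (Fin; zero; suc)
  open import Data.Integer as ℤ using (ℤ; ∣_∣; 1ℤ)
  import Data.Integer.Properties as ℤP
  open import Data.Integer.Tactic.RingSolver using (solve-∀)
  open import Data.Rational as ℚ using (ℚ; _/_; ↥_)
  open import Data.Vec using (Vec; []; _∷_; lookup; tabulate)
  open import Relation.Binary.PropositionalEquality

  1≤⌈log₂⌉ : ∀ {n} → 2 ≤ n → 1 ≤ ⌈log₂ n ⌉
  1≤⌈log₂⌉ {n} 2≤n = subst (_≤ ⌈log₂ n ⌉) (⌈log₂2^n⌉≡n 1) (⌈log₂⌉-mono-≤ 2≤n)

  n≤2^⌈log₂n⌉ : ∀ n → n ≤ 2 ^ ⌈log₂ n ⌉
  n≤2^⌈log₂n⌉ = <-rec (λ n → n ≤ 2 ^ ⌈log₂ n ⌉) bound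
    where
    bound : ∀ n → (∀ {m} → m < n → m ≤ 2 ^ ⌈log₂ m ⌉) → n ≤ 2 ^ ⌈log₂ n ⌉
    bound zero _ = z≤n
    bound (suc zero) _ = ≤-refl
    bound n@(suc (suc k)) smaller = begin
      n                    ≡⟨ ⌊n/2⌋+⌈n/2⌉≡n n ⟨
      ℕ.⌊ n /2⌋ + ⌈ n /2⌉  ≤⟨ +-monoˡ-≤ ⌈ n /2⌉ (⌊n/2⌋≤⌈n/2⌉ n) ⟩
      ⌈ n /2⌉ + ⌈ n /2⌉    ≤⟨ +-mono-≤ half≤ half≤ ⟩
      2 ^ L + 2 ^ L        ≡⟨ cong (2 ^ L +_) (+-identityʳ (2 ^ L)) ⟨
      2 ^ suc L            ≡⟨ cong (2 ^_) (trans (cong suc (⌈log₂⌈n/2⌉⌉≡⌈log₂n⌉∸1 n))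
                                                 (m+[n∸m]≡n (1≤⌈log₂⌉ {n} (s≤s (s≤s z≤n))))) ⟩
      2 ^ ⌈log₂ n ⌉        ∎
      where
      open ≤-Reasoning
      L : ℕ
      L = ⌈log₂ ⌈ n /2⌉ ⌉
      half≤ : ⌈ n /2⌉ ≤ 2 ^ L
      half≤ = smaller (⌈n/2⌉<n k)

  RESℚ-/-≤ : ∀ N d .{{_ : NonZero d}} {k} → suc ∣ N ∣ ≤ 2 ^ k → suc d ≤ 2 ^ k → RESℚ (N / d) ≤ k
  RESℚ-/-≤ N d {k} suc∣N∣≤ suc[d]≤ =
    ⊔-lub (⌈log₂⌉≤ (≤-trans ∣↥+1∣≤ suc∣N∣≤))
          (⌈log₂⌉≤ (≤-trans (s≤s (↧ₙ[N/d]≤d N d)) suc[d]≤))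
    where
    ⌈log₂⌉≤ : ∀ {m} → m ≤ 2 ^ k → ⌈log₂ m ⌉ ≤ k
    ⌈log₂⌉≤ {m} m≤ = subst (⌈log₂ m ⌉ ≤_) (⌈log₂2^n⌉≡n k) (⌈log₂⌉-mono-≤ m≤)
    ∣↥+1∣≤ : ∣ ↥ (N / d) ℤ.+ 1ℤ ∣ ≤ suc ∣ N ∣
    ∣↥+1∣≤ = ≤-trans (ℤP.∣i+j∣≤∣i∣+∣j∣ (↥ (N / d)) 1ℤ)
                     (subst (_≤ suc ∣ N ∣) (+-comm 1 ∣ ↥ (N / d) ∣) (s≤s (∣↥[N/d]∣≤∣N∣ N d)))

  1≤RESℚ : ∀ q → 1 ≤ RESℚ q
  1≤RESℚ q = ≤-trans (1≤⌈log₂⌉ {suc (ℚ.denominatorℕ q)} (s≤s (s≤s z≤n))) (m≤n⊔m _ _)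

  suc∣x∣≤2^suc[RES] : ∀ x → suc ∣ x ∣ ≤ 2 ^ suc (RESℚ (x / 1))
  suc∣x∣≤2^suc[RES] x = begin
    suc ∣ x ∣             ≤⟨ s≤s ∣x∣≤1+∣x+1∣ ⟩
    2 + ∣ x ℤ.+ 1ℤ ∣       ≤⟨ +-mono-≤ (^-monoʳ-≤ 2 (1≤RESℚ (x / 1))) ∣x+1∣≤2^R ⟩
    2 ^ R + 2 ^ R          ≡⟨ cong (2 ^ R +_) (+-identityʳ (2 ^ R)) ⟨
    2 ^ suc R              ∎
    where
    open ≤-Reasoning
    R : ℕ
    R = RESℚ (x / 1)
    ∣x∣≤1+∣x+1∣ : ∣ x ∣ ≤ 1 + ∣ x ℤ.+ 1ℤ ∣
    ∣x∣≤1+∣x+1∣ = subst (λ y → ∣ y ∣ ≤ 1 + ∣ x ℤ.+ 1ℤ ∣) (cancel x)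
                        (ℤP.∣i+j∣≤∣i∣+∣j∣ ℤ.-1ℤ (x ℤ.+ 1ℤ))
      where
      cancel : ∀ x → ℤ.-1ℤ ℤ.+ (x ℤ.+ 1ℤ) ≡ x
      cancel = solve-∀
    ∣x+1∣≤2^R : ∣ x ℤ.+ 1ℤ ∣ ≤ 2 ^ R
    ∣x+1∣≤2^R = ≤-trans (n≤2^⌈log₂n⌉ ∣ x ℤ.+ 1ℤ ∣)
      (^-monoʳ-≤ 2 (subst (λ y → ⌈log₂ ∣ y ℤ.+ 1ℤ ∣ ⌉ ≤ R) (↥[N/1]≡N x) (m≤m⊔n _ _)))

  RES-lookup≤RESℤvec : ∀ {n} (w : Vec ℤ n) i → RESℚ (lookup w i / 1) ≤ RESℤvec w
  RES-lookup≤RESℤvec (x ∷ w) zero = m≤m⊔n _ _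
  RES-lookup≤RESℤvec (x ∷ w) (suc i) = ≤-trans (RES-lookup≤RESℤvec w i) (m≤n⊔m _ _)

  RESℤvec-lub : ∀ {n} (w : Vec ℤ n) {k} → (∀ i → RESℚ (lookup w i / 1) ≤ k) → RESℤvec w ≤ k
  RESℤvec-lub [] _ = z≤n
  RESℤvec-lub (x ∷ w) entries≤ = ⊔-lub (entries≤ zero) (RESℤvec-lub w (λ i → entries≤ (suc i)))

  RESℚvec-tabulate-lub : ∀ {n} (g : Fin n → ℚ) {k} → (∀ i → RESℚ (g i) ≤ k) → RESℚvec (tabulate g) ≤ k
  RESℚvec-tabulate-lub {zero} g _ = z≤n
  RESℚvec-tabulate-lub {suc n} g entries≤ =
    ⊔-lub (entries≤ zero) (RESℚvec-tabulate-lub (λ i → g (suc i)) (λ i → entries≤ (suc i)))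

module Anchors where

  open Determinants using (_·_; ·-distribˡ-+; ·-scaleʳ)
  open Threshold
  open Rationals
  open Resolution
  open Search using (optimalInput)
  open import Data.Nat as ℕ using (ℕ; zero; suc; NonZero)
  import Data.Nat.Properties as ℕP
  open import Data.Fin using (Fin; zero; suc)
  open import Data.Bool using (Bool; true; false)
  import Data.Bool.Properties as BoolP
  open import Data.Vec using (Vec; []; _∷_; lookup; tabulate)
  open import Data.Vec.Functional using (Vector)
  open import Data.Integer as ℤ using (ℤ; -_; _+_; _-_; _*_; 0ℤ; ∣_∣; _≤_; _<_)
  open import Data.Integer.Properties
  open import Data.Integer.Tactic.RingSolver using (solve-∀)
  import Data.Nat.Tactic.RingSolver as ℕSolver
  open import Algebra.Properties.Semiring.Sum +-*-semiring using (sum; sum-cong-≗; ∑-distrib-+; *-distribˡ-sum)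
  open import Data.Rational as ℚ using (ℚ; _/_)
  import Data.Rational.Properties as ℚP
  import Data.Rational.Solver as ℚSolver
  open import Data.List using (List; []; _∷_; length)
  open import Data.List.Relation.Unary.Any using (here)
  open import Data.List.Relation.Unary.All using ([]; _∷_)
  open import Data.List.Membership.Propositional using (_∈_)
  open import Data.Product using (Σ; ∃; _×_; _,_; proj₁; proj₂)
  open import Relation.Nullary using (¬_; contradiction)
  open import Relation.Binary.PropositionalEquality

  sqDist : ∀ {n} → Vector ℤ n → Vector ℤ n → ℤ
  sqDist t a = sum (λ i → (t i - a i) * (t i - a i))

  anchor : ∀ {n} (d : ℕ) .{{_ : NonZero d}} → Vector ℤ n → Vec ℚ n
  anchor d a = tabulate (λ i → a i / d)

  scaled : ∀ {n} → ℕ → BVec n → Vector ℤ n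
  scaled d X i = ℤ.+ d * bits X i

  dist²-anchor : ∀ {n} d .{{_ : NonZero d}} (X : BVec n) (a : Vector ℤ n) →
    ι (ℤ.+ d * ℤ.+ d) ℚ.* dist² X (anchor d a) ≡ ι (sqDist (scaled d X) a)
  dist²-anchor d [] a = ℚP.*-zeroʳ (ι (ℤ.+ d * ℤ.+ d))
  dist²-anchor d (x ∷ X) a = begin
    ι (D * D) ℚ.* (sq (bitℚ x ℚ.- r) ℚ.+ dist² X (anchor d a′))
      ≡⟨ ℚP.*-distribˡ-+ (ι (D * D)) (sq (bitℚ x ℚ.- r)) (dist² X (anchor d a′)) ⟩
    ι (D * D) ℚ.* sq (bitℚ x ℚ.- r) ℚ.+ ι (D * D) ℚ.* dist² X (anchor d a′)
      ≡⟨ cong₂ ℚ._+_ coordinate (dist²-anchor d X a′) ⟩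
    ι ((D * bitℤ x - a zero) ²) ℚ.+ ι (sqDist (scaled d X) a′)
      ≡⟨ ι-+ ((D * bitℤ x - a zero) ²) (sqDist (scaled d X) a′) ⟨
    ι (sqDist (scaled d (x ∷ X)) a) ∎
    where
    open ≡-Reasoning
    sq : ℚ → ℚ
    sq y = y ℚ.* y
    _² : ℤ → ℤ
    y ² = y * y
    D : ℤ
    D = ℤ.+ d
    r : ℚ
    r = a zero / d
    a′ : Vector ℤ _
    a′ i = a (suc i)
    expand : ∀ (D x r : ℚ) → (D ℚ.* D) ℚ.* sq (x ℚ.- r) ≡ sq (D ℚ.* x ℚ.- D ℚ.* r)
    expand = solve 3 (λ D x r → (D :* D) :* ((x :- r) :* (x :- r)) := (D :* x :- D :* r) :* (D :* x :- D :* r))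
                     refl
      where open ℚSolver.+-*-Solver
    coordinate : ι (D * D) ℚ.* sq (bitℚ x ℚ.- r) ≡ ι ((D * bitℤ x - a zero) ²)
    coordinate = begin
      ι (D * D) ℚ.* sq (bitℚ x ℚ.- r)
        ≡⟨ cong₂ (λ s y → s ℚ.* sq (y ℚ.- r)) (ι-* D D) (bitℚ≡ι x) ⟩
      (ι D ℚ.* ι D) ℚ.* sq (ι (bitℤ x) ℚ.- r)
        ≡⟨ expand (ι D) (ι (bitℤ x)) r ⟩
      sq (ι D ℚ.* ι (bitℤ x) ℚ.- ι D ℚ.* r)
        ≡⟨ cong₂ (λ s y → sq (s ℚ.- y)) (sym (ι-* D (bitℤ x))) (ι[d]*[N/d]≡ι[N] (a zero) d) ⟩
      sq (ι (D * bitℤ x) ℚ.- ι (a zero))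
        ≡⟨ cong sq (ι-minus (D * bitℤ x) (a zero)) ⟨
      sq (ι (D * bitℤ x - a zero))
        ≡⟨ ι-* (D * bitℤ x - a zero) (D * bitℤ x - a zero) ⟨
      ι ((D * bitℤ x - a zero) ²) ∎

  nearer-anchor : ∀ {n} d .{{_ : NonZero d}} (X : BVec n) (a b : Vector ℤ n) →
    sqDist (scaled d X) a < sqDist (scaled d X) b → dist² X (anchor d a) ℚ.< dist² X (anchor d b)
  nearer-anchor d X a b a<b = ℚP.*-cancelˡ-<-nonNeg (ι (ℤ.+ d * ℤ.+ d)) {{ℚ.nonNegative (ℚP.<⇒≤ 0<D²)}}
    (subst₂ ℚ._<_ (sym (dist²-anchor d X a)) (sym (dist²-anchor d X b)) (ι-mono-< a<b))
    where
    0<D² : ℚ.0ℚ ℚ.< ι (ℤ.+ d * ℤ.+ d)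
    0<D² = ι-mono-< (subst (0ℤ <_) (pos-* d d) (ℤ.+<+ (ℕ.>-nonZero⁻¹ (d ℕ.* d) {{ℕP.m*n≢0 d d}})))

  -- The perpendicular bisector of M ± v, with both sides moved so that no subtraction occurs.
  bisector : ∀ {n} (t M v : Vector ℤ n) →
    sqDist t (λ i → M i + v i) + ℤ.+ 4 * (v · t) ≡ sqDist t (λ i → M i - v i) + ℤ.+ 4 * (v · M)
  bisector t M v = begin
    sum (λ i → sq₊ i) + ℤ.+ 4 * (v · t)
      ≡⟨ cong (sum (λ i → sq₊ i) +_) (*-distribˡ-sum (ℤ.+ 4) (λ i → v i * t i)) ⟩
    sum (λ i → sq₊ i) + sum (λ i → ℤ.+ 4 * (v i * t i))
      ≡⟨ ∑-distrib-+ (λ i → sq₊ i) (λ i → ℤ.+ 4 * (v i * t i)) ⟨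
    sum (λ i → sq₊ i + ℤ.+ 4 * (v i * t i))
      ≡⟨ sum-cong-≗ (λ i → coordinate (t i) (M i) (v i)) ⟩
    sum (λ i → sq₋ i + ℤ.+ 4 * (v i * M i))
      ≡⟨ ∑-distrib-+ (λ i → sq₋ i) (λ i → ℤ.+ 4 * (v i * M i)) ⟩
    sum (λ i → sq₋ i) + sum (λ i → ℤ.+ 4 * (v i * M i))
      ≡⟨ cong (sum (λ i → sq₋ i) +_) (*-distribˡ-sum (ℤ.+ 4) (λ i → v i * M i)) ⟨
    sum (λ i → sq₋ i) + ℤ.+ 4 * (v · M) ∎
    where
    open ≡-Reasoning
    sq₊ sq₋ : _ → ℤ
    sq₊ i = (t i - (M i + v i)) * (t i - (M i + v i))
    sq₋ i = (t i - (M i - v i)) * (t i - (M i - v i))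
    coordinate : ∀ t M v →
      (t - (M + v)) * (t - (M + v)) + ℤ.+ 4 * (v * t) ≡ (t - (M - v)) * (t - (M - v)) + ℤ.+ 4 * (v * M)
    coordinate = solve-∀

  private
    +-cancelʳ-< : ∀ a b c → a + c < b + c → a < b
    +-cancelʳ-< a b c a+c<b+c = subst₂ _<_ (cancel a c) (cancel b c) (+-monoˡ-< (- c) a+c<b+c)
      where
      cancel : ∀ x c → x + c + - c ≡ x
      cancel = solve-∀

  nearer-plus : ∀ {n} (t M v : Vector ℤ n) → v · M < v · t →
    sqDist t (λ i → M i + v i) < sqDist t (λ i → M i - v i)
  nearer-plus t M v v·M<v·t = +-cancelʳ-< d₊ d₋ (ℤ.+ 4 * (v · t)) (begin-strict
    d₊ + ℤ.+ 4 * (v · t)  ≡⟨ bisector t M v ⟩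
    d₋ + ℤ.+ 4 * (v · M)  <⟨ +-monoʳ-< d₋ (*-monoˡ-<-pos (ℤ.+ 4) v·M<v·t) ⟩
    d₋ + ℤ.+ 4 * (v · t)  ∎)
    where
    open ≤-Reasoning
    d₊ d₋ : ℤ
    d₊ = sqDist t (λ i → M i + v i)
    d₋ = sqDist t (λ i → M i - v i)

  nearer-minus : ∀ {n} (t M v : Vector ℤ n) → v · t < v · M →
    sqDist t (λ i → M i - v i) < sqDist t (λ i → M i + v i)
  nearer-minus t M v v·t<v·M = +-cancelʳ-< d₋ d₊ (ℤ.+ 4 * (v · M)) (begin-strict
    d₋ + ℤ.+ 4 * (v · M)  ≡⟨ bisector t M v ⟨
    d₊ + ℤ.+ 4 * (v · t)  <⟨ +-monoʳ-< d₊ (*-monoˡ-<-pos (ℤ.+ 4) v·t<v·M) ⟩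
    d₊ + ℤ.+ 4 * (v · M)  ∎)
    where
    open ≤-Reasoning
    d₊ d₋ : ℤ
    d₊ = sqDist t (λ i → M i + v i)
    d₋ = sqDist t (λ i → M i - v i)

  private
    RES[N/2]≤ : ∀ {N x R} → ∣ N ∣ ℕ.≤ 2 ℕ.+ ∣ x ∣ → suc ∣ x ∣ ℕ.≤ 2 ℕ.^ suc R →
      RESℚ (N / 2) ℕ.≤ 2 ℕ.+ R
    RES[N/2]≤ {N} {x} {R} ∣N∣≤ suc∣x∣≤ =
      RESℚ-/-≤ N 2 (ℕP.≤-trans (ℕ.s≤s ∣N∣≤) numerator≤) denominator≤
      where
      2≤2^suc[R] : 2 ℕ.≤ 2 ℕ.^ suc R
      2≤2^suc[R] = ℕP.^-monoʳ-≤ 2 {1} {suc R} (ℕ.s≤s ℕ.z≤n)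
      numerator≤ : 2 ℕ.+ suc ∣ x ∣ ℕ.≤ 2 ℕ.^ (2 ℕ.+ R)
      numerator≤ = ℕP.≤-trans (ℕP.+-mono-≤ 2≤2^suc[R] suc∣x∣≤)
                              (ℕP.≤-reflexive (cong (2 ℕ.^ suc R ℕ.+_) (sym (ℕP.+-identityʳ (2 ℕ.^ suc R)))))
      denominator≤ : 3 ℕ.≤ 2 ℕ.^ (2 ℕ.+ R)
      denominator≤ = ℕP.≤-trans (ℕP.n≤1+n 3) (ℕP.^-monoʳ-≤ 2 (ℕP.m≤m+n 2 R))

  1≤RESℤvec : ∀ {n} (w : Vec ℤ n) b → NonConstant (LTF w b) → 1 ℕ.≤ RESℤvec w
  1≤RESℤvec [] b ([] , [] , fX , fY) = contradiction (trans (sym fX) fY) λ ()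
  1≤RESℤvec (x ∷ _) _ _ = ℕP.≤-trans (1≤RESℚ (x / 1)) (ℕP.m≤m⊔n _ _)

  TwoAnchorRepresentation : ∀ {n} → (BVec n → Bool) → ℕ → Set
  TwoAnchorRepresentation {n} f r = Σ (List (Vec ℚ n)) λ P → Σ (List (Vec ℚ n)) λ N →
    NNRep f P N × length P ℕ.+ length N ≡ 2 × RESrep P N ℕ.≤ r

  TwoAnchorRepresentation-cong : ∀ {n} {f g : BVec n → Bool} {r} → (∀ X → f X ≡ g X) →
    TwoAnchorRepresentation f r → TwoAnchorRepresentation g r
  TwoAnchorRepresentation-cong f≗g (P , N , (disjoint , nearest) , two , res≤) =
    P , N , (disjoint , λ X → (λ gX → proj₁ (nearest X) (trans (f≗g X) gX)) ,
                              (λ gX → proj₂ (nearest X) (trans (f≗g X) gX))) , two , res≤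

  module _ {n} (w : Vec ℤ n) (b : ℤ) (nonConstant : NonConstant (LTF w b)) where

    private
      value : BVec n → ℤ
      value X = dotℤ w X

      lightestTrue : Σ (BVec n) λ X → LTF w b X ≡ true × ∀ Y → LTF w b Y ≡ true → value X ≤ value Y
      lightestTrue = optimalInput (λ X → LTF w b X BoolP.≟ true) _≤_ ≤-total ≤-trans value
        (let X , _ , fX , _ = nonConstant in X , fX)

      heaviestFalse : Σ (BVec n) λ X → LTF w b X ≡ false × ∀ Y → LTF w b Y ≡ false → value Y ≤ value X
      heaviestFalse = optimalInput (λ X → LTF w b X BoolP.≟ false) (λ a c → c ≤ a) (λ a c → ≤-total c a)
        (λ c≤a d≤c → ≤-trans d≤c c≤a) value (let _ , Y , _ , fY = nonConstant in Y , fY)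

      x⁺ x⁻ : BVec n
      x⁺ = proj₁ lightestTrue
      x⁻ = proj₁ heaviestFalse

      x⁺-true : LTF w b x⁺ ≡ true
      x⁺-true = proj₁ (proj₂ lightestTrue)

      x⁺-lightest : ∀ X → LTF w b X ≡ true → value x⁺ ≤ value X
      x⁺-lightest = proj₂ (proj₂ lightestTrue)

      x⁻-heaviest : ∀ X → LTF w b X ≡ false → value X ≤ value x⁻
      x⁻-heaviest = proj₂ (proj₂ heaviestFalse)

      x⁻<x⁺ : value x⁻ < value x⁺
      x⁻<x⁺ = <-≤-trans (LTF≡false⇒ w b x⁻ (proj₁ (proj₂ heaviestFalse))) (LTF≡true⇒ w b x⁺ x⁺-true)

      M : Vector ℤ n
      M i = bits x⁺ i + bits x⁻ i

      p q : Vec ℚ n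
      p = anchor 2 (λ i → M i + lookup w i)
      q = anchor 2 (λ i → M i - lookup w i)

      w·M : lookup w · M ≡ value x⁺ + value x⁻
      w·M = trans (·-distribˡ-+ (lookup w) (bits x⁺) (bits x⁻)) (sym (cong₂ _+_ (dotℤ≡· w x⁺) (dotℤ≡· w x⁻)))

      w·2X : ∀ X → lookup w · scaled 2 X ≡ value X + value X
      w·2X X = trans (·-scaleʳ (lookup w) (bits X) (ℤ.+ 2))
                     (trans (double (lookup w · bits X)) (sym (cong₂ _+_ (dotℤ≡· w X) (dotℤ≡· w X))))
        where
        double : ∀ x → ℤ.+ 2 * x ≡ x + x
        double = solve-∀

      p-nearer : ∀ X → LTF w b X ≡ true → dist² X p ℚ.< dist² X q
      p-nearer X fX = nearer-anchor 2 X _ _ (nearer-plus (scaled 2 X) M (lookup w)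
        (subst₂ _<_ (sym w·M) (sym (w·2X X))
          (+-mono-≤-< (x⁺-lightest X fX) (<-≤-trans x⁻<x⁺ (x⁺-lightest X fX)))))

      q-nearer : ∀ X → LTF w b X ≡ false → dist² X q ℚ.< dist² X p
      q-nearer X fX = nearer-anchor 2 X _ _ (nearer-minus (scaled 2 X) M (lookup w)
        (subst₂ _<_ (sym (w·2X X)) (sym w·M)
          (+-mono-<-≤ (≤-<-trans (x⁻-heaviest X fX) x⁻<x⁺) (x⁻-heaviest X fX))))

      nnRep : NNRep (LTF w b) (p ∷ []) (q ∷ [])
      nnRep = disjoint , λ X → (λ fX → here (p-nearer X fX ∷ [])) , (λ fX → here (q-nearer X fX ∷ []))
        where
        disjoint : ∀ x → ¬ (x ∈ p ∷ [] × x ∈ q ∷ [])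
        disjoint x (here x≡p , here x≡q) =
          ℚP.<-irrefl (cong (dist² x⁺) (trans (sym x≡p) x≡q)) (p-nearer x⁺ x⁺-true)

      R : ℕ
      R = RESℤvec w

      entry≤ : ∀ {N} i → ∣ N ∣ ℕ.≤ ∣ M i ∣ ℕ.+ ∣ lookup w i ∣ → RESℚ (N / 2) ℕ.≤ 2 ℕ.+ R
      entry≤ {N} i ∣N∣≤ = RES[N/2]≤ {N} {lookup w i} {R}
        (ℕP.≤-trans ∣N∣≤ (ℕP.+-monoˡ-≤ ∣ lookup w i ∣ ∣M∣≤2))
        (ℕP.≤-trans (suc∣x∣≤2^suc[RES] (lookup w i)) (ℕP.^-monoʳ-≤ 2 (ℕ.s≤s (RES-lookup≤RESℤvec w i))))
        where
        ∣M∣≤2 : ∣ M i ∣ ℕ.≤ 2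
        ∣M∣≤2 = ℕP.≤-trans (∣i+j∣≤∣i∣+∣j∣ (bits x⁺ i) (bits x⁻ i))
                           (ℕP.+-mono-≤ (∣bitℤ∣≤1 (lookup x⁺ i)) (∣bitℤ∣≤1 (lookup x⁻ i)))

      RES[p,q]≤2+R : RESrep (p ∷ []) (q ∷ []) ℕ.≤ 2 ℕ.+ R
      RES[p,q]≤2+R = ℕP.⊔-lub
        (RESℚvec-tabulate-lub (λ i → (M i + lookup w i) / 2)
          (λ i → entry≤ {M i + lookup w i} i (∣i+j∣≤∣i∣+∣j∣ (M i) (lookup w i))))
        (ℕP.⊔-lub (RESℚvec-tabulate-lub (λ i → (M i - lookup w i) / 2)
          (λ i → entry≤ {M i - lookup w i} i (∣i-j∣≤∣i∣+∣j∣ (M i) (lookup w i)))) ℕ.z≤n)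

      2+R≤3R : 2 ℕ.+ R ℕ.≤ 3 ℕ.* R
      2+R≤3R = ℕP.≤-trans (ℕP.+-monoˡ-≤ R (ℕP.+-mono-≤ 1≤R 1≤R)) (ℕP.≤-reflexive (three-times R))
        where
        1≤R : 1 ℕ.≤ R
        1≤R = 1≤RESℤvec w b nonConstant
        three-times : ∀ R → R ℕ.+ R ℕ.+ R ≡ 3 ℕ.* R
        three-times = ℕSolver.solve-∀

    twoAnchors : TwoAnchorRepresentation (LTF w b) (3 ℕ.* RESℤvec w)
    twoAnchors = p ∷ [] , q ∷ [] , nnRep , refl , ℕP.≤-trans RES[p,q]≤2+R 2+R≤3R

open Anchors using (TwoAnchorRepresentation; TwoAnchorRepresentation-cong; twoAnchors)
open SmallWeights using (smallWeights)
open Resolution using (n≤2^⌈log₂n⌉; 1≤⌈log₂⌉; RESℚ-/-≤; RESℤvec-lub)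
open import Data.Nat using (ℕ; zero; suc; _≤_; _*_; _+_; _^_; _!; z≤n; s≤s)
open import Data.Nat.Properties
open import Data.Nat.Logarithm using (⌈log₂_⌉; ⌈log₂⌉-mono-≤; ⌈log₂2*n⌉≡1+⌈log₂n⌉)
open import Data.Nat.Tactic.RingSolver using (solve-∀)
open import Data.Integer using (ℤ; ∣_∣)
open import Data.Rational using (ℚ)
open import Data.Vec using (Vec; lookup)
open import Data.List using (List; length)
open import Data.Product using (Σ; _×_; _,_)
open import Relation.Binary.PropositionalEquality

n!≤n^n : ∀ n → n ! ≤ n ^ n
n!≤n^n zero = ≤-refl
n!≤n^n (suc n) = *-monoʳ-≤ (suc n) (≤-trans (n!≤n^n n) (^-monoˡ-≤ n (n≤1+n n)))

suc[n!]≤2^suc[⌈log₂n⌉*n] : ∀ n → suc (n !) ≤ 2 ^ suc (⌈log₂ n ⌉ * n)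
suc[n!]≤2^suc[⌈log₂n⌉*n] n = begin
  1 + n !         ≤⟨ +-mono-≤ (m^n>0 2 E) n!≤2^E ⟩
  2 ^ E + 2 ^ E   ≡⟨ cong (2 ^ E +_) (+-identityʳ (2 ^ E)) ⟨
  2 ^ suc E       ∎
  where
  open ≤-Reasoning
  E : ℕ
  E = ⌈log₂ n ⌉ * n
  n!≤2^E : n ! ≤ 2 ^ E
  n!≤2^E = ≤-trans (n!≤n^n n) (≤-trans (^-monoˡ-≤ n (n≤2^⌈log₂n⌉ n)) (≤-reflexive (^-*-assoc 2 ⌈log₂ n ⌉ n)))

RESℤvec≤ : ∀ {n} (w : Vec ℤ n) m → (∀ i → ∣ lookup w i ∣ ≤ m !) → RESℤvec w ≤ suc (⌈log₂ m ⌉ * m)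
RESℤvec≤ w m ∣w∣≤m! = RESℤvec-lub w λ i → RESℚ-/-≤ (lookup w i) 1
  (≤-trans (s≤s (∣w∣≤m! i)) (suc[n!]≤2^suc[⌈log₂n⌉*n] m)) (^-monoʳ-≤ 2 {1} {suc (⌈log₂ m ⌉ * m)} (s≤s z≤n))

suc[⌈log₂[1+n]⌉*[1+n]]≤5*n*⌈log₂n⌉ : ∀ {n} → 2 ≤ n → suc (⌈log₂ suc n ⌉ * suc n) ≤ 5 * (n * ⌈log₂ n ⌉)
suc[⌈log₂[1+n]⌉*[1+n]]≤5*n*⌈log₂n⌉ {suc zero} (s≤s ())
suc[⌈log₂[1+n]⌉*[1+n]]≤5*n*⌈log₂n⌉ {n@(suc (suc _))} 2≤n = begin
  1 + ⌈log₂ suc n ⌉ * suc n   ≤⟨ +-mono-≤ 1≤nℓ (*-mono-≤ log≤ suc[n]≤2n) ⟩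
  n * ℓ + (ℓ + ℓ) * (2 * n)   ≡⟨ collect n ℓ ⟩
  5 * (n * ℓ)                 ∎
  where
  open ≤-Reasoning
  ℓ : ℕ
  ℓ = ⌈log₂ n ⌉
  1≤ℓ : 1 ≤ ℓ
  1≤ℓ = 1≤⌈log₂⌉ {n} 2≤n
  1≤nℓ : 1 ≤ n * ℓ
  1≤nℓ = *-mono-≤ {1} {n} (s≤s z≤n) 1≤ℓ
  suc[n]≤2n : suc n ≤ 2 * n
  suc[n]≤2n = ≤-trans (s≤s (m≤m+n n 0)) (+-monoˡ-≤ (n + 0) {1} {n} (s≤s z≤n))
  log≤ : ⌈log₂ suc n ⌉ ≤ ℓ + ℓ
  log≤ = ≤-trans (⌈log₂⌉-mono-≤ suc[n]≤2n)
                 (≤-trans (≤-reflexive (⌈log₂2*n⌉≡1+⌈log₂n⌉ n)) (+-monoˡ-≤ ℓ 1≤ℓ))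
  collect : ∀ n ℓ → n * ℓ + (ℓ + ℓ) * (2 * n) ≡ 5 * (n * ℓ)
  collect = solve-∀

twoSmallAnchors : ∀ n → 2 ≤ n → ∀ (w : Vec ℤ n) (b : ℤ) → NonConstant (LTF w b) →
  TwoAnchorRepresentation (LTF w b) (15 * (n * ⌈log₂ n ⌉))
twoSmallAnchors n 2≤n w b (X , Y , fX , fY) =
  let w′ , b′ , same , ∣w′∣≤ = smallWeights w b
      P , N , rep , two , res≤ = TwoAnchorRepresentation-cong same
        (twoAnchors w′ b′ (X , Y , trans (same X) fX , trans (same Y) fY))
  in P , N , rep , two , ≤-trans res≤ (≤-trans
       (*-monoʳ-≤ 3 (≤-trans (RESℤvec≤ w′ (suc n) ∣w′∣≤) (suc[⌈log₂[1+n]⌉*[1+n]]≤5*n*⌈log₂n⌉ 2≤n)))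
       (≤-reflexive (sym (*-assoc 3 5 (n * ⌈log₂ n ⌉)))))

theorem6 :
    (Σ ℕ λ C → ∀ (n : ℕ) (w : Vec ℤ n) (b : ℤ) → NonConstant (LTF w b) →
      Σ (List (Vec ℚ n)) λ P → Σ (List (Vec ℚ n)) λ N →
        NNRep (LTF w b) P N × length P + length N ≡ 2 × RESrep P N ≤ C * RESℤvec w)
    ×
    (Σ ℕ λ C → Σ ℕ λ n₀ → ∀ (n : ℕ) → n₀ ≤ n → ∀ (w : Vec ℤ n) (b : ℤ) → NonConstant (LTF w b) →
      Σ (List (Vec ℚ n)) λ P → Σ (List (Vec ℚ n)) λ N →
        NNRep (LTF w b) P N × length P + length N ≡ 2 × RESrep P N ≤ C * (n * ⌈log₂ n ⌉))
theorem6 = (3 , λ n → twoAnchors) , (15 , 2 , twoSmallAnchors)
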